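{- Let $G$ be a bipartite graph of maximum degree $\Delta$ revealed in the one-sided vertex arrival model in an arbitrary order, and run Algorithm A with any parameter $q>0$. For an online arrival time $t$, a color $c\in\mathcal{C}$ and an offline node $v$, let $Z^t_{cv}$ be the indicator that color $c$ is not used by any edge of $v$ when $w_t$ arrives (i.e., among edges colored before time $t$). Then for every time $t$: (i) for every color $c\in\mathcal{C}$ and offline node $v$, $$\Pr[Z^t_{cv}=1] = \frac{\Delta-d_t(v)+q}{\Delta+q};$$ (ii) for every color $c\in\mathcal{C}$ and offline nodes $v_1,\dots,v_k$, $$\Pr\Big[\bigwedge_{i\in[k]} (Z^t_{cv_i}=1)\Big] \leq \prod_{i\in[k]}\Pr[Z^t_{cv_i}=1].$$
   Context: One-sided vertex arrival model: $G$ is bipartite with an offline side and an online side. Initially only $n$, $\Delta$ and the offline nodes are known. At time $t=1,2,\dots$ an online node $w_t$ is revealed together with all its edges (to offline nodes), and each of these edges must immediately and irrevocably be assigned a color. For an offline node $v$, $d_t(v)$ denotes the number of edges between $v$ and $w_1,\dots,w_{t-1}$, and $N_G(w_t)$ is the set of neighbors of $w_t$. Algorithm A with parameter $q>0$ uses the color set $\mathcal{C}=[\Delta+q]$. When $w_t$ arrives: (1) let $H_t$ be the bipartite graph with vertex sets $N_G(w_t)$ and $\mathcal{C}$, in which $v\in N_G(w_t)$ and $c\in\mathcal{C}$ are adjacent iff no edge of $v$ has been colored $c$ so far; (2) for each $c\in\mathcal{C}$ and offline $v$, set $x^t_{cv} = \mathbb{1}[cv\in H_t]/(\Delta-d_t(v)+q)$;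 (3) if $\sum_v x^t_{cv}\leq 1$ for every color $c$, sample (with fresh randomness) a random matching $M_t$ of $H_t$ with exact marginals $\Pr[cv\in M_t]=x^t_{cv}$ for all $c,v$, and color each edge $\{v,w_t\}$ with the color matched to $v$ in $M_t$; (4) otherwise (failure mode), color each edge $\{v,w_t\}$ with a color chosen uniformly at random from the neighbors of $v$ in $H_t$, independently for different $v$. -}

module Defs where

open import Data.Bool using (Bool; true; false; if_then_else_; not; _∧_; _∨_)
open import Data.Nat as ℕ using (ℕ; zero; suc; _∸_)
open import Data.Integer using (+_)
open import Data.Rational using (ℚ; 0ℚ; 1ℚ; _/_; _+_; _*_; _≤_; _≤?_)
open import Data.Fin using (Fin; _≟_)
open import Data.Fin.Subset using (Subset; ∣_∣)
open import Data.Vec using (lookup)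
open import Data.List using (List; []; _∷_; map; foldr; filter; length; concatMap; allFin; take; reverse)
open import Data.Bool.ListAction using (any; all)
open import Data.List.Membership.Propositional using (_∈_)
open import Data.List.Relation.Unary.All using (All)
open import Data.Maybe using (Maybe; just; nothing)
open import Data.Product using (_×_; _,_; Σ; ∃; proj₁; proj₂)
open import Data.Sum using (_⊎_)
open import Relation.Nullary.Decidable using (does; ⌊_⌋)
open import Relation.Binary.PropositionalEquality using (_≡_)
import Data.Maybe.Properties as MP

Dist : Set → Set
Dist A = List (ℚ × A)

sumℚ : List ℚ → ℚ
sumℚ = foldr _+_ 0ℚ

prodℚ : List ℚ → ℚ
prodℚ = foldr _*_ 1ℚ

return : {A : Set} → A → Dist A
return a = (1ℚ , a) ∷ []

bind : {A B : Set} → Dist A → (A → Dist B) → Dist B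
bind D k = concatMap (λ pa → map (λ rb → (proj₁ pa * proj₁ rb , proj₂ rb)) (k (proj₂ pa))) D

-- 1/k as a rational (with the junk value 1/0 = 0; never used at 0 below since q ≥ 1)
recip : ℕ → ℚ
recip zero = 0ℚ
recip (suc k) = (+ 1) / suc k

frac : ℕ → ℕ → ℚ
frac a b = ((+ a) / 1) * recip b

uniform : {A : Set} → List A → Dist A
uniform L = map (λ a → (recip (length L) , a)) L

Pr : {A : Set} → (A → Bool) → Dist A → ℚ
Pr P D = sumℚ (map (λ pa → if P (proj₂ pa) then proj₁ pa else 0ℚ) D)

IsDist : {A : Set} → Dist A → Set
IsDist D = All (λ pa → 0ℚ ≤ proj₁ pa) D × sumℚ (map proj₁ D) ≡ 1ℚ

module _ (m Δ q : ℕ) where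
  -- offline nodes: Fin m ; colors: 𝒞 = [Δ + q] = Fin (Δ + q)
  Color : Set
  Color = Fin (Δ ℕ.+ q)

  -- an online node is given by its neighbourhood (a subset of offline nodes);
  -- `adj w v` is true iff v ∈ N_G(w)
  adj : Subset m → Fin m → Bool
  adj w v = lookup w v

  -- the colouring of the edges of one online node w: v ↦ colour of {v,w}
  -- (nothing if no colour assigned / v not adjacent)
  StepCol : Set
  StepCol = Fin m → Maybe Color

  deg : List (Subset m) → Fin m → ℕ
  deg ws v = length (filter (λ w → adj w v ≟ᵇ true) ws)
    where
      open import Data.Bool.Properties renaming (_≟_ to _≟ᵇ_)

  used : List StepCol → Fin m → Color → Bool
  used h v c = any (λ s → does (MP.≡-dec _≟_ (s v) (just c))) h

  MaxDegree : List (Subset m) → Set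
  MaxDegree ws = All (λ w → ∣ w ∣ ℕ.≤ Δ) ws
               × (∀ v → deg ws v ℕ.≤ Δ)
               × ((Σ (Subset m) λ w → w ∈ ws × ∣ w ∣ ≡ Δ) ⊎ (Σ (Fin m) λ v → deg ws v ≡ Δ))

  IsMatching : Subset m → (Fin m → Color → Bool) → StepCol → Set
  IsMatching w H f =
      (∀ v c → f v ≡ just c → adj w v ≡ true × H v c ≡ true)
    × (∀ v v' c → f v ≡ just c → f v' ≡ just c → v ≡ v')

  AdmissibleX : Subset m → (Fin m → Color → Bool) → (Fin m → Color → ℚ) → Set
  AdmissibleX w H x =
      (∀ v c → 0ℚ ≤ x v c)
    × (∀ v c → (adj w v ∧ H v c) ≡ false → x v c ≡ 0ℚ)
    × (∀ c → sumℚ (map (λ v → x v c) (allFin m)) ≤ 1ℚ)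
    × (∀ v → sumℚ (map (λ c → x v c) (allFin (Δ ℕ.+ q))) ≤ 1ℚ)

  -- A sampler: given N(w_t), H_t and x^t, returns a distribution over matchings
  Sampler : Set
  Sampler = Subset m → (Fin m → Color → Bool) → (Fin m → Color → ℚ) → Dist StepCol

  ValidSampler : Sampler → Set
  ValidSampler S = ∀ w H x → AdmissibleX w H x →
      IsDist (S w H x)
    × All (λ pf → IsMatching w H (proj₂ pf)) (S w H x)
    × (∀ v c → Pr (λ f → does (MP.≡-dec _≟_ (f v) (just c))) (S w H x) ≡ x v c)

  colors : List Color
  colors = allFin (Δ ℕ.+ q)

  -- failure mode: each v ∈ N(w) independently gets a uniform free colour
  failureDist : Subset m → (Fin m → Color → Bool) → Dist StepCol
  failureDist w H = foldr extend (return (λ _ → nothing)) (allFin m)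
    where
      extend : Fin m → Dist StepCol → Dist StepCol
      extend v D = if adj w v
        then bind D (λ f → map (λ pc → (proj₁ pc , λ u → if does (u ≟ v) then just (proj₂ pc) else f u))
                               (uniform (filter (λ c → H v c ≟ᵇ true) colors)))
        else D
        where open import Data.Bool.Properties renaming (_≟_ to _≟ᵇ_)

  step : Sampler → List (Subset m) → List StepCol → Subset m → Dist StepCol
  step S past h w =
    if all (λ c → ⌊ sumℚ (map (λ v → x v c) (allFin m)) ≤? 1ℚ ⌋) colors
    then S w H x
    else failureDist w H
    where
      H : Fin m → Color → Bool
      H v c = adj w v ∧ not (used h v c)
      x : Fin m → Color → ℚ
      x v c = if H v c then recip (Δ ∸ deg past v ℕ.+ q) else 0ℚ

  -- the joint distribution of all colourings; input arrivals most recent first,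
  -- output colourings most recent first
  runRev : Sampler → List (Subset m) → Dist (List StepCol)
  runRev S [] = return []
  runRev S (w ∷ past) =
    bind (runRev S past) (λ h → map (λ ps → (proj₁ ps , proj₂ ps ∷ h)) (step S past h w))

  -- distribution of the colouring history just before w_t (0-indexed) arrives
  histAt : Sampler → List (Subset m) → ℕ → Dist (List StepCol)
  histAt S ws t = runRev S (reverse (take t ws))

  dAt : List (Subset m) → ℕ → Fin m → ℕ
  dAt ws t v = deg (take t ws) v

  Z : Color → Fin m → List StepCol → Bool
  Z c v h = not (used h v c)

  allZ : Color → List (Fin m) → List StepCol → Bool
  allZ c vs h = all (λ v → Z c v h) vs

-- In every history of positive probability each offline node v has exactly
-- Δ - d_t(v) + q free colours: every step gives each neighbour of w_t one of its free
-- colours (in matching mode the rows of x^t sum to 1, so the random matching covers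
-- N(w_t) almost surely).  Hence, given the history, a neighbour v of w_t for which c is
-- free loses c at step t with probability exactly y_v = 1/(Δ - d_t(v) + q): in matching
-- mode this is the marginal x^t_{cv}, in failure mode v draws one of its free colours
-- uniformly.  The survival factors 1 - y_v telescope to (Δ - d_t(v) + q)/(Δ + q), which
-- is (i).  For (ii), in matching mode c goes to at most one node, so all of v_1, ..., v_k
-- keep c with probability 1 - Σ y_{v_i} ≤ Π (1 - y_{v_i}); in failure mode the nodes
-- draw independently and the probability is exactly the product.

module Submission where

open import Data.Nat using (ℕ)

module RationalFacts where
  open import Defs using (recip)
  open import Data.Nat as ℕ using (ℕ; zero; suc; s≤s; z≤n)
  import Data.Nat.Properties as ℕP
  open import Data.Integer as ℤ using (+_)
  import Data.Integer.Properties as ℤP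
  open import Data.Integer.Tactic.RingSolver using (solve-∀)
  open import Data.Rational using (ℚ; 0ℚ; 1ℚ; _/_; _+_; _*_; _-_; -_; _≤_; toℚᵘ; nonNegative)
  open import Data.Rational.Properties
  import Data.Rational.Unnormalised as U
  import Data.Rational.Unnormalised.Properties as UP
  open import Data.Rational.Solver using (module +-*-Solver)
  open import Data.Product using (_×_; _,_)
  open import Relation.Binary.PropositionalEquality
  open +-*-Solver

  ι : ℕ → ℚ
  ι n = + n / 1

  private
    toℚᵘ-ι : ∀ n → toℚᵘ (ι n) U.≃ U.mkℚᵘ (+ n) 0
    toℚᵘ-ι n = toℚᵘ-fromℚᵘ (U.mkℚᵘ (+ n) 0)

    toℚᵘ-recip : ∀ k → toℚᵘ (recip (suc k)) U.≃ U.mkℚᵘ (+ 1) k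
    toℚᵘ-recip k = toℚᵘ-fromℚᵘ (U.mkℚᵘ (+ 1) k)

  ι-suc : ∀ n → ι (suc n) ≡ 1ℚ + ι n
  ι-suc n = toℚᵘ-injective (begin
      toℚᵘ (ι (suc n))              ≈⟨ toℚᵘ-ι (suc n) ⟩
      U.mkℚᵘ (+ suc n) 0            ≈⟨ U.*≡* (ℤ-identity (+ n)) ⟩
      U.1ℚᵘ U.+ U.mkℚᵘ (+ n) 0      ≈⟨ UP.+-congʳ U.1ℚᵘ (UP.≃-sym (toℚᵘ-ι n)) ⟩
      U.1ℚᵘ U.+ toℚᵘ (ι n)          ≈⟨ UP.≃-sym (toℚᵘ-homo-+ 1ℚ (ι n)) ⟩
      toℚᵘ (1ℚ + ι n)               ∎)
    where
    open UP.≃-Reasoning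
    ℤ-identity : ∀ z → (+ 1 ℤ.+ z) ℤ.* + 1 ≡ (+ 1 ℤ.* + 1 ℤ.+ z ℤ.* + 1) ℤ.* + 1
    ℤ-identity = solve-∀

  ι-*-recip : ∀ n → ι (suc n) * recip (suc n) ≡ 1ℚ
  ι-*-recip n = toℚᵘ-injective (begin
      toℚᵘ (ι (suc n) * recip (suc n))                  ≈⟨ toℚᵘ-homo-* (ι (suc n)) (recip (suc n)) ⟩
      toℚᵘ (ι (suc n)) U.* toℚᵘ (recip (suc n))         ≈⟨ UP.*-cong (toℚᵘ-ι (suc n)) (toℚᵘ-recip n) ⟩
      U.mkℚᵘ (+ suc n) 0 U.* U.mkℚᵘ (+ 1) n             ≈⟨ U.*≡* cross ⟩
      U.1ℚᵘ                                             ∎)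
    where
    open UP.≃-Reasoning
    cross : (+ suc n ℤ.* + 1) ℤ.* + 1 ≡ + 1 ℤ.* + suc (n ℕ.+ 0)
    cross = trans (ℤP.*-identityʳ _) (trans (ℤP.*-identityʳ _)
              (trans (cong (λ k → + suc k) (sym (ℕP.+-identityʳ n))) (sym (ℤP.*-identityˡ _))))

  ι-*-recip-suc : ∀ k → ι k * recip (suc k) ≡ 1ℚ - recip (suc k)
  ι-*-recip-suc k = begin
      ι k * r                   ≡⟨ distrib (ι k) r ⟩
      (1ℚ + ι k) * r - r        ≡⟨ cong (λ x → x * r - r) (sym (ι-suc k)) ⟩
      ι (suc k) * r - r         ≡⟨ cong (_- r) (ι-*-recip k) ⟩
      1ℚ - r                    ∎
    where
    open ≡-Reasoning
    r : ℚ
    r = recip (suc k)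
    distrib : ∀ i r → i * r ≡ (1ℚ + i) * r - r
    distrib = solve 2 (λ i r → i :* r := (con 1ℚ :+ i) :* r :- r) refl

  1-recip-*-ι : ∀ k r → (1ℚ - recip (suc k)) * (ι (suc k) * r) ≡ ι k * r
  1-recip-*-ι k r = begin
      (1ℚ - recip (suc k)) * (ι (suc k) * r)        ≡⟨ cong (_* (ι (suc k) * r)) (sym (ι-*-recip-suc k)) ⟩
      ι k * recip (suc k) * (ι (suc k) * r)         ≡⟨ regroup (ι k) (recip (suc k)) (ι (suc k)) r ⟩
      ι k * (ι (suc k) * recip (suc k) * r)         ≡⟨ cong (λ one → ι k * (one * r)) (ι-*-recip k) ⟩
      ι k * (1ℚ * r)                                ≡⟨ cong (ι k *_) (*-identityˡ r) ⟩
      ι k * r                                       ∎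
    where
    open ≡-Reasoning
    regroup : ∀ a b c d → a * b * (c * d) ≡ a * (c * b * d)
    regroup = solve 4 (λ a b c d → a :* b :* (c :* d) := a :* (c :* b :* d)) refl

  nonneg-+-≡0 : ∀ {a b} → 0ℚ ≤ a → 0ℚ ≤ b → a + b ≡ 0ℚ → a ≡ 0ℚ × b ≡ 0ℚ
  nonneg-+-≡0 {a} {b} 0≤a 0≤b a+b≡0 = ≤-antisym a≤0 0≤a , ≤-antisym b≤0 0≤b
    where
    a≤0 : a ≤ 0ℚ
    a≤0 = ≤-trans (≤-trans (≤-reflexive (sym (+-identityʳ a))) (+-monoʳ-≤ a 0≤b)) (≤-reflexive a+b≡0)
    b≤0 : b ≤ 0ℚ
    b≤0 = ≤-trans (≤-trans (≤-reflexive (sym (+-identityˡ b))) (+-monoˡ-≤ b 0≤a)) (≤-reflexive a+b≡0)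

  ι-nonneg : ∀ n → 0ℚ ≤ ι n
  ι-nonneg n = nonNegative⁻¹ _ {{normalize-nonNeg n 1}}

  recip-nonneg : ∀ k → 0ℚ ≤ recip k
  recip-nonneg zero = ≤-refl
  recip-nonneg (suc k) = nonNegative⁻¹ _ {{normalize-nonNeg 1 (suc k)}}

  recip-≤1 : ∀ k → recip k ≤ 1ℚ
  recip-≤1 zero = ι-nonneg 1
  recip-≤1 (suc k) = toℚᵘ-cancel-≤ (UP.≤-respˡ-≃ (UP.≃-sym (toℚᵘ-recip k)) (U.*≤* (ℤ.+≤+ (s≤s z≤n))))

  *-nonneg : ∀ {p r} → 0ℚ ≤ p → 0ℚ ≤ r → 0ℚ ≤ p * r
  *-nonneg {p} {r} 0≤p 0≤r = nonNegative⁻¹ _ {{nonNeg*nonNeg⇒nonNeg p {{nonNegative 0≤p}} r {{nonNegative 0≤r}}}}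

  ≤1⇒1-nonneg : ∀ {p} → p ≤ 1ℚ → 0ℚ ≤ 1ℚ - p
  ≤1⇒1-nonneg {p} p≤1 = ≤-trans (≤-reflexive (sym (+-inverseʳ p))) (+-monoˡ-≤ (- p) p≤1)

module FiniteExpectation where
  open import Defs using (Dist; sumℚ; return; bind; Pr; recip; uniform)
  open RationalFacts using (ι; ι-suc; ι-*-recip; ι-nonneg; *-nonneg; nonneg-+-≡0)
  open import Data.Bool using (Bool; true; false; if_then_else_)
  open import Data.Rational using (ℚ; 0ℚ; 1ℚ; _+_; _*_; _-_; -_; _≤_; _≟_; nonNegative)
  open import Data.Rational.Properties hiding (_≟_)
  open import Data.Rational.Solver using (module +-*-Solver)
  open import Data.Nat using (ℕ; suc)
  open import Data.List using (List; []; _∷_; map; _++_; length)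
  open import Data.List.Relation.Unary.All as All using (All; []; _∷_)
  import Data.List.Relation.Unary.All.Properties as All
  open import Data.Product using (_×_; _,_; proj₁; proj₂)
  open import Data.Sum using (_⊎_; inj₁; inj₂)
  import Data.Sum as Sum
  open import Relation.Nullary using (yes; no)
  open import Data.Empty using (⊥-elim)
  open import Relation.Binary.PropositionalEquality
  open +-*-Solver

  𝟙 : Bool → ℚ
  𝟙 b = if b then 1ℚ else 0ℚ

  𝟙-nonneg : ∀ b → 0ℚ ≤ 𝟙 b
  𝟙-nonneg true = ι-nonneg 1
  𝟙-nonneg false = ≤-refl

  𝔼 : {A : Set} → (A → ℚ) → Dist A → ℚ
  𝔼 g D = sumℚ (map (λ pa → proj₁ pa * g (proj₂ pa)) D)

  module _ {A : Set} where
    Pr-as-𝔼 : (P : A → Bool) (D : Dist A) → Pr P D ≡ 𝔼 (λ a → 𝟙 (P a)) D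
    Pr-as-𝔼 P [] = refl
    Pr-as-𝔼 P ((p , a) ∷ D) with P a
    ... | true = cong₂ _+_ (sym (*-identityʳ p)) (Pr-as-𝔼 P D)
    ... | false = cong₂ _+_ (sym (*-zeroʳ p)) (Pr-as-𝔼 P D)

    𝔼-++ : (g : A → ℚ) (D₁ D₂ : Dist A) → 𝔼 g (D₁ ++ D₂) ≡ 𝔼 g D₁ + 𝔼 g D₂
    𝔼-++ g [] D₂ = sym (+-identityˡ _)
    𝔼-++ g ((p , a) ∷ D₁) D₂ =
      trans (cong (p * g a +_) (𝔼-++ g D₁ D₂)) (sym (+-assoc (p * g a) (𝔼 g D₁) (𝔼 g D₂)))

    𝔼-scale : (g : A → ℚ) (p : ℚ) (D : Dist A) →
      𝔼 g (map (λ rb → (p * proj₁ rb , proj₂ rb)) D) ≡ p * 𝔼 g D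
    𝔼-scale g p [] = sym (*-zeroʳ p)
    𝔼-scale g p ((r , b) ∷ D) =
      trans (cong₂ _+_ (*-assoc p r (g b)) (𝔼-scale g p D)) (sym (*-distribˡ-+ p _ _))

    𝔼-cong : {f g : A → ℚ} (D : Dist A) → (∀ a → f a ≡ g a) → 𝔼 f D ≡ 𝔼 g D
    𝔼-cong [] f≗g = refl
    𝔼-cong ((p , a) ∷ D) f≗g = cong₂ _+_ (cong (p *_) (f≗g a)) (𝔼-cong D f≗g)

    𝔼-cong-weighted : {f g : A → ℚ} (D : Dist A) →
      All (λ pa → proj₁ pa * f (proj₂ pa) ≡ proj₁ pa * g (proj₂ pa)) D → 𝔼 f D ≡ 𝔼 g D
    𝔼-cong-weighted [] [] = refl
    𝔼-cong-weighted (_ ∷ D) (e ∷ es) = cong₂ _+_ e (𝔼-cong-weighted D es)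

    𝔼-mono-weighted : {f g : A → ℚ} (D : Dist A) →
      All (λ pa → proj₁ pa * f (proj₂ pa) ≤ proj₁ pa * g (proj₂ pa)) D → 𝔼 f D ≤ 𝔼 g D
    𝔼-mono-weighted [] [] = ≤-refl
    𝔼-mono-weighted (_ ∷ D) (e ∷ es) = +-mono-≤ e (𝔼-mono-weighted D es)

    𝔼-*ˡ : (r : ℚ) (f : A → ℚ) (D : Dist A) → 𝔼 (λ a → r * f a) D ≡ r * 𝔼 f D
    𝔼-*ˡ r f [] = sym (*-zeroʳ r)
    𝔼-*ˡ r f ((p , a) ∷ D) =
      trans (cong₂ _+_ (swap p r (f a)) (𝔼-*ˡ r f D)) (sym (*-distribˡ-+ r _ _))
      where
      swap : ∀ p r x → p * (r * x) ≡ r * (p * x)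
      swap = solve 3 (λ p r x → p :* (r :* x) := r :* (p :* x)) refl

    𝔼-+ : (f g : A → ℚ) (D : Dist A) → 𝔼 (λ a → f a + g a) D ≡ 𝔼 f D + 𝔼 g D
    𝔼-+ f g [] = refl
    𝔼-+ f g ((p , a) ∷ D) =
      trans (cong₂ _+_ (*-distribˡ-+ p (f a) (g a)) (𝔼-+ f g D)) (interchange (p * f a) (p * g a) (𝔼 f D) (𝔼 g D))
      where
      interchange : ∀ a b c d → (a + b) + (c + d) ≡ (a + c) + (b + d)
      interchange = solve 4 (λ a b c d → (a :+ b) :+ (c :+ d) := (a :+ c) :+ (b :+ d)) refl

    𝔼-neg : (f : A → ℚ) (D : Dist A) → 𝔼 (λ a → - f a) D ≡ - 𝔼 f D
    𝔼-neg f [] = refl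
    𝔼-neg f ((p , a) ∷ D) =
      trans (cong₂ _+_ (sym (neg-distribʳ-* p (f a))) (𝔼-neg f D)) (sym (neg-distrib-+ (p * f a) (𝔼 f D)))

    𝔼-- : (f g : A → ℚ) (D : Dist A) → 𝔼 (λ a → f a - g a) D ≡ 𝔼 f D - 𝔼 g D
    𝔼-- f g D = trans (𝔼-+ f (λ a → - g a) D) (cong (𝔼 f D +_) (𝔼-neg g D))

    𝔼-1 : (D : Dist A) → 𝔼 (λ _ → 1ℚ) D ≡ sumℚ (map proj₁ D)
    𝔼-1 [] = refl
    𝔼-1 ((p , a) ∷ D) = cong₂ _+_ (*-identityʳ p) (𝔼-1 D)

    𝔼-0 : (D : Dist A) → 𝔼 (λ _ → 0ℚ) D ≡ 0ℚ
    𝔼-0 [] = refl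
    𝔼-0 ((p , a) ∷ D) = trans (cong₂ _+_ (*-zeroʳ p) (𝔼-0 D)) (+-identityˡ 0ℚ)

    𝔼-sum : {I : Set} (is : List I) (g : I → A → ℚ) (D : Dist A) →
      𝔼 (λ a → sumℚ (map (λ i → g i a) is)) D ≡ sumℚ (map (λ i → 𝔼 (g i) D) is)
    𝔼-sum [] g D = 𝔼-0 D
    𝔼-sum (i ∷ is) g D = trans (𝔼-+ (g i) _ D) (cong (𝔼 (g i) D +_) (𝔼-sum is g D))

  𝟙-*-cong : ∀ {b x y} → (b ≡ true → x ≡ y) → 𝟙 b * x ≡ 𝟙 b * y
  𝟙-*-cong {true} x≡y = cong (1ℚ *_) (x≡y refl)
  𝟙-*-cong {false} {x} {y} _ = trans (*-zeroˡ x) (sym (*-zeroˡ y))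

  𝟙-*-mono : ∀ {b x y} → (b ≡ true → x ≤ y) → 𝟙 b * x ≤ 𝟙 b * y
  𝟙-*-mono {true} x≤y = *-monoˡ-≤-nonNeg 1ℚ (x≤y refl)
  𝟙-*-mono {false} {x} {y} _ = ≤-reflexive (trans (*-zeroˡ x) (sym (*-zeroˡ y)))

  𝔼-𝟙-* : {A : Set} (P : A → Bool) (r : ℚ) (D : Dist A) → 𝔼 (λ a → 𝟙 (P a) * r) D ≡ r * Pr P D
  𝔼-𝟙-* P r D =
    trans (𝔼-cong D (λ a → *-comm (𝟙 (P a)) r)) (trans (𝔼-*ˡ r _ D) (cong (r *_) (sym (Pr-as-𝔼 P D))))

  module _ {A B : Set} where
    𝔼-bind : (g : B → ℚ) (D : Dist A) (k : A → Dist B) → 𝔼 g (bind D k) ≡ 𝔼 (λ a → 𝔼 g (k a)) D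
    𝔼-bind g [] k = refl
    𝔼-bind g ((p , a) ∷ D) k =
      trans (𝔼-++ g (map (λ rb → (p * proj₁ rb , proj₂ rb)) (k a)) (bind D k))
            (cong₂ _+_ (𝔼-scale g p (k a)) (𝔼-bind g D k))

    𝔼-map₂ : (g : B → ℚ) (F : A → B) (D : Dist A) →
      𝔼 g (map (λ pa → (proj₁ pa , F (proj₂ pa))) D) ≡ 𝔼 (λ a → g (F a)) D
    𝔼-map₂ g F [] = refl
    𝔼-map₂ g F ((p , a) ∷ D) = cong (p * g (F a) +_) (𝔼-map₂ g F D)

  module _ {A : Set} where
    sum-1 : (xs : List A) → sumℚ (map (λ _ → 1ℚ) xs) ≡ ι (length xs)
    sum-1 [] = refl
    sum-1 (x ∷ xs) = trans (cong (1ℚ +_) (sum-1 xs)) (sym (ι-suc (length xs)))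

    𝔼-uniform : (g : A → ℚ) (xs : List A) → 𝔼 g (uniform xs) ≡ recip (length xs) * sumℚ (map g xs)
    𝔼-uniform g xs = go xs
      where
      go : (ys : List A) → 𝔼 g (map (λ a → (recip (length xs) , a)) ys) ≡ recip (length xs) * sumℚ (map g ys)
      go [] = sym (*-zeroʳ (recip (length xs)))
      go (y ∷ ys) = trans (cong (recip (length xs) * g y +_) (go ys)) (sym (*-distribˡ-+ (recip (length xs)) (g y) _))

    uniform-mass : {k : ℕ} (xs : List A) → length xs ≡ suc k → 𝔼 (λ _ → 1ℚ) (uniform xs) ≡ 1ℚ
    uniform-mass {k} xs len≡ = begin
      𝔼 (λ _ → 1ℚ) (uniform xs)                    ≡⟨ 𝔼-uniform (λ _ → 1ℚ) xs ⟩
      recip (length xs) * sumℚ (map (λ _ → 1ℚ) xs) ≡⟨ cong (recip (length xs) *_) (sum-1 xs) ⟩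
      recip (length xs) * ι (length xs)            ≡⟨ cong (λ n → recip n * ι n) len≡ ⟩
      recip (suc k) * ι (suc k)                    ≡⟨ *-comm (recip (suc k)) (ι (suc k)) ⟩
      ι (suc k) * recip (suc k)                    ≡⟨ ι-*-recip k ⟩
      1ℚ                                           ∎
      where open ≡-Reasoning

  AlmostSurelyAt : {A : Set} → (A → Set) → ℚ × A → Set
  AlmostSurelyAt P (p , a) = 0ℚ ≤ p × (p ≡ 0ℚ ⊎ P a)

  AlmostSurely : {A : Set} → (A → Set) → Dist A → Set
  AlmostSurely P = All (AlmostSurelyAt P)

  module _ {A : Set} {P Q : A → Set} where
    as-mono : (∀ {a} → P a → Q a) → {D : Dist A} → AlmostSurely P D → AlmostSurely Q D
    as-mono P⇒Q = All.map (λ (0≤p , p≡0⊎Pa) → 0≤p , Sum.map₂ P⇒Q p≡0⊎Pa)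

  module _ {A : Set} {P : A → Set} where
    as-𝔼-cong : {f g : A → ℚ} (D : Dist A) → AlmostSurely P D → (∀ a → P a → f a ≡ g a) → 𝔼 f D ≡ 𝔼 g D
    as-𝔼-cong {f} {g} D asP f≗g = 𝔼-cong-weighted D (All.map atom asP)
      where
      atom : ∀ {pa} → AlmostSurelyAt P pa → proj₁ pa * f (proj₂ pa) ≡ proj₁ pa * g (proj₂ pa)
      atom {p , a} (_ , inj₁ refl) = trans (*-zeroˡ (f a)) (sym (*-zeroˡ (g a)))
      atom {p , a} (_ , inj₂ Pa) = cong (p *_) (f≗g a Pa)

    as-𝔼-mono : {f g : A → ℚ} (D : Dist A) → AlmostSurely P D → (∀ a → P a → f a ≤ g a) → 𝔼 f D ≤ 𝔼 g D
    as-𝔼-mono {f} {g} D asP f≤g = 𝔼-mono-weighted D (All.map atom asP)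
      where
      atom : ∀ {pa} → AlmostSurelyAt P pa → proj₁ pa * f (proj₂ pa) ≤ proj₁ pa * g (proj₂ pa)
      atom {p , a} (_ , inj₁ refl) = ≤-reflexive (trans (*-zeroˡ (f a)) (sym (*-zeroˡ (g a))))
      atom {p , a} (0≤p , inj₂ Pa) = *-monoˡ-≤-nonNeg p {{nonNegative 0≤p}} (f≤g a Pa)

  module _ {A : Set} where
    NonNegWeights : Dist A → Set
    NonNegWeights = All (λ pa → 0ℚ ≤ proj₁ pa)

    as-return : {P : A → Set} {a : A} → P a → AlmostSurely P (return a)
    as-return Pa = (ι-nonneg 1 , inj₂ Pa) ∷ []

    as-always : {P : A → Set} (D : Dist A) → NonNegWeights D → (∀ a → P a) → AlmostSurely P D
    as-always [] [] Pa = []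
    as-always ((p , a) ∷ D) (0≤p ∷ nn) Pa = (0≤p , inj₂ (Pa a)) ∷ as-always D nn Pa

    as-All : {P Q : A → Set} {D : Dist A} → AlmostSurely P D → All (λ pa → Q (proj₂ pa)) D →
      AlmostSurely (λ a → P a × Q a) D
    as-All [] [] = []
    as-All ((0≤p , inj₁ p≡0) ∷ asP) (_ ∷ allQ) = (0≤p , inj₁ p≡0) ∷ as-All asP allQ
    as-All ((0≤p , inj₂ Pa) ∷ asP) (Qa ∷ allQ) = (0≤p , inj₂ (Pa , Qa)) ∷ as-All asP allQ

    as-∀ : {I : Set} {P : I → A → Set} (D : Dist A) → NonNegWeights D →
      (∀ i → AlmostSurely (P i) D) → AlmostSurely (λ a → ∀ i → P i a) D
    as-∀ [] [] asP = []
    as-∀ ((p , a) ∷ D) (0≤p ∷ nn) asP with p ≟ 0ℚ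
    ... | yes p≡0 = (0≤p , inj₁ p≡0) ∷ as-∀ D nn (λ i → All.tail (asP i))
    ... | no p≢0 = (0≤p , inj₂ (λ i → positive-atom (proj₂ (All.head (asP i)))))
                   ∷ as-∀ D nn (λ i → All.tail (asP i))
      where
      positive-atom : ∀ {X : Set} → p ≡ 0ℚ ⊎ X → X
      positive-atom (inj₁ p≡0) = ⊥-elim (p≢0 p≡0)
      positive-atom (inj₂ x) = x

    𝔼-nonneg : (g : A → ℚ) (D : Dist A) → NonNegWeights D → (∀ a → 0ℚ ≤ g a) → 0ℚ ≤ 𝔼 g D
    𝔼-nonneg g [] [] 0≤g = ≤-refl
    𝔼-nonneg g ((p , a) ∷ D) (0≤p ∷ nn) 0≤g =
      ≤-trans (≤-reflexive (sym (+-identityˡ 0ℚ))) (+-mono-≤ (*-nonneg 0≤p (0≤g a)) (𝔼-nonneg g D nn 0≤g))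

    as-of-𝔼-𝟙≡0 : (P : A → Bool) (D : Dist A) → NonNegWeights D →
      𝔼 (λ a → 𝟙 (P a)) D ≡ 0ℚ → AlmostSurely (λ a → P a ≡ false) D
    as-of-𝔼-𝟙≡0 P [] [] _ = []
    as-of-𝔼-𝟙≡0 P ((p , a) ∷ D) (0≤p ∷ nn) 𝔼≡0 =
      (0≤p , head (P a) refl) ∷ as-of-𝔼-𝟙≡0 P D nn (proj₂ split)
      where
      split : p * 𝟙 (P a) ≡ 0ℚ × 𝔼 (λ a → 𝟙 (P a)) D ≡ 0ℚ
      split = nonneg-+-≡0 (*-nonneg 0≤p (𝟙-nonneg (P a))) (𝔼-nonneg _ D nn (λ a → 𝟙-nonneg (P a))) 𝔼≡0
      head : (b : Bool) → P a ≡ b → p ≡ 0ℚ ⊎ P a ≡ false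
      head true Pa≡true = inj₁ (trans (sym (*-identityʳ p)) (trans (cong (λ b → p * 𝟙 b) (sym Pa≡true)) (proj₁ split)))
      head false Pa≡false = inj₂ Pa≡false

  module _ {A B : Set} {P : A → Set} {Q : B → Set} where
    as-bind : (D : Dist A) (k : A → Dist B) → AlmostSurely P D →
      (∀ a → P a → AlmostSurely Q (k a)) → AlmostSurely Q (bind D k)
    as-bind [] k [] asQ = []
    as-bind ((p , a) ∷ D) k ((0≤p , p≡0⊎Pa) ∷ asP) asQ =
      All.++⁺ (scaled (k a) (Sum.map₂ (asQ a) p≡0⊎Pa)) (as-bind D k asP asQ)
      where
      scaled : (K : Dist B) → p ≡ 0ℚ ⊎ AlmostSurely Q K →
        AlmostSurely Q (map (λ rb → (p * proj₁ rb , proj₂ rb)) K)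
      scaled [] _ = []
      scaled ((r , b) ∷ K) (inj₁ refl) = (≤-reflexive (sym (*-zeroˡ r)) , inj₁ (*-zeroˡ r)) ∷ scaled K (inj₁ refl)
      scaled ((r , b) ∷ K) (inj₂ (atom ∷ asK)) = scale atom ∷ scaled K (inj₂ asK)
        where
        scale : AlmostSurelyAt Q (r , b) → AlmostSurelyAt Q (p * r , b)
        scale (0≤r , inj₁ refl) = *-nonneg 0≤p 0≤r , inj₁ (*-zeroʳ p)
        scale (0≤r , inj₂ Qb) = *-nonneg 0≤p 0≤r , inj₂ Qb

    as-map₂ : (F : A → B) (D : Dist A) → AlmostSurely P D → (∀ a → P a → Q (F a)) →
      AlmostSurely Q (map (λ pa → (proj₁ pa , F (proj₂ pa))) D)
    as-map₂ F [] [] P⇒QF = []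
    as-map₂ F ((p , a) ∷ D) ((0≤p , p≡0⊎Pa) ∷ asP) P⇒QF =
      (0≤p , Sum.map₂ (P⇒QF a) p≡0⊎Pa) ∷ as-map₂ F D asP P⇒QF

module Counting where
  open import Defs using (sumℚ; recip; uniform)
  open RationalFacts using (ι; ι-suc)
  open FiniteExpectation using (𝟙; 𝔼; 𝔼-uniform)
  open import Data.Bool using (Bool; true; false; if_then_else_; not; _∧_)
  open import Data.Bool.Properties using (∧-identityʳ; ∧-inverseʳ) renaming (_≟_ to _≟ᵇ_)
  open import Data.Bool.ListAction using (all)
  open import Data.Nat using (ℕ; suc; _≤_)
  open import Data.Rational using (ℚ; 0ℚ; 1ℚ; _+_; _*_)
  open import Data.Rational.Properties using (*-zeroˡ; *-identityˡ; *-identityʳ; +-identityˡ; *-distribʳ-+; *-comm)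
  open import Data.List using (List; []; _∷_; map; filter; length; reverse)
  open import Data.List.Relation.Unary.All as All using (All; []; _∷_)
  open import Data.List.Relation.Unary.Any using (here; there)
  open import Data.List.Membership.Propositional using (_∈_)
  open import Data.List.Relation.Unary.Unique.Propositional using (Unique)
  open import Data.List.Relation.Unary.AllPairs using (_∷_)
  open import Data.List.Relation.Binary.Sublist.Propositional using (_⊆_)
  open import Data.List.Relation.Binary.Sublist.Propositional.Properties using (filter⁺; length-mono-≤)
  open import Data.List.Relation.Binary.Permutation.Propositional.Properties using (↭-length; filter-↭; ↭-reverse)
  open import Relation.Binary.Definitions using (DecidableEquality)
  open import Relation.Nullary using (Dec; yes; no; contradiction)
  open import Relation.Nullary.Decidable using (does; dec-true; dec-false)
  open import Relation.Binary.PropositionalEquality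

  ∧-true-right : ∀ {a b} → (a ∧ b) ≡ true → b ≡ true
  ∧-true-right {true} e = e

  does⇒ : ∀ {P : Set} (d : Dec P) → does d ≡ true → P
  does⇒ (yes p) _ = p

  bool-cases : ∀ {ℓ} {P : Set ℓ} (b : Bool) → (b ≡ true → P) → (b ≡ false → P) → P
  bool-cases true on-true _ = on-true refl
  bool-cases false _ on-false = on-false refl

  count : {A : Set} → (A → Bool) → List A → ℕ
  count P xs = length (filter (λ a → P a ≟ᵇ true) xs)

  module _ {A : Set} where
    count-cong-All : {P Q : A → Bool} (xs : List A) → All (λ a → P a ≡ Q a) xs → count P xs ≡ count Q xs
    count-cong-All [] [] = refl
    count-cong-All {P} {Q} (x ∷ xs) (Px≡Qx ∷ eqs) rewrite Px≡Qx with Q x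
    ... | true = cong suc (count-cong-All xs eqs)
    ... | false = count-cong-All xs eqs

    count-cong : {P Q : A → Bool} (xs : List A) → (∀ a → P a ≡ Q a) → count P xs ≡ count Q xs
    count-cong xs P≗Q = count-cong-All xs (All.tabulate (λ {a} _ → P≗Q a))

    count-filter : (P Q : A → Bool) (xs : List A) →
      count Q (filter (λ a → P a ≟ᵇ true) xs) ≡ count (λ a → P a ∧ Q a) xs
    count-filter P Q [] = refl
    count-filter P Q (x ∷ xs) with P x
    ... | false = count-filter P Q xs
    ... | true with Q x
    ... | true = cong suc (count-filter P Q xs)
    ... | false = count-filter P Q xs

    count-mono-⊆ : (P : A → Bool) {xs ys : List A} → xs ⊆ ys → count P xs ≤ count P ys
    count-mono-⊆ P xs⊆ys =
      length-mono-≤ (filter⁺ (λ a → P a ≟ᵇ true) (λ a → P a ≟ᵇ true) (λ { refl Pa → Pa }) xs⊆ys)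

    count-const-false : (xs : List A) → count (λ _ → false) xs ≡ 0
    count-const-false [] = refl
    count-const-false (x ∷ xs) = count-const-false xs

    all-true-lookup : (P : A → Bool) {xs : List A} → all P xs ≡ true → {x : A} → x ∈ xs → P x ≡ true
    all-true-lookup P {x ∷ xs} all≡true x∈ with P x in Px
    all-true-lookup P {x ∷ xs} all≡true (here refl) | true = Px
    all-true-lookup P {x ∷ xs} all≡true (there x∈) | true = all-true-lookup P all≡true x∈

    count-reverse : (P : A → Bool) (xs : List A) → count P (reverse xs) ≡ count P xs
    count-reverse P xs = ↭-length (filter-↭ (λ a → P a ≟ᵇ true) (↭-reverse xs))

    sum-if : (P : A → Bool) (r : ℚ) (xs : List A) →
      sumℚ (map (λ a → if P a then r else 0ℚ) xs) ≡ ι (count P xs) * r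
    sum-if P r [] = sym (*-zeroˡ r)
    sum-if P r (x ∷ xs) with P x
    ... | true = begin
        r + sumℚ (map (λ a → if P a then r else 0ℚ) xs)
          ≡⟨ cong (r +_) (sum-if P r xs) ⟩
        r + ι (count P xs) * r
          ≡⟨ sym (trans (*-distribʳ-+ r 1ℚ (ι (count P xs))) (cong (_+ ι (count P xs) * r) (*-identityˡ r))) ⟩
        (1ℚ + ι (count P xs)) * r
          ≡⟨ cong (_* r) (sym (ι-suc (count P xs))) ⟩
        ι (suc (count P xs)) * r ∎
      where open ≡-Reasoning
    ... | false = trans (+-identityˡ _) (sum-if P r xs)

  module _ {A : Set} (_≟_ : DecidableEquality A) where
    count-remove : (P : A → Bool) {a : A} (xs : List A) → Unique xs → a ∈ xs → P a ≡ true →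
      count P xs ≡ suc (count (λ b → P b ∧ not (does (a ≟ b))) xs)
    count-remove P (x ∷ xs) (x∉xs ∷ _) (here refl) Px with P x | x ≟ x
    ... | true | yes _ = cong suc (count-cong-All xs (All.map unchanged x∉xs))
      where
      unchanged : ∀ {b} → x ≢ b → P b ≡ (P b ∧ not (does (x ≟ b)))
      unchanged {b} x≢b = sym (trans (cong (λ d → P b ∧ not d) (dec-false (x ≟ b) x≢b)) (∧-identityʳ (P b)))
    ... | true | no x≢x = contradiction refl x≢x
    ... | false | _ = contradiction Px (λ ())
    count-remove P {a} (x ∷ xs) (x∉xs ∷ u) (there a∈xs) Pa with P x | a ≟ x
    ... | _ | yes refl = contradiction refl (All.lookup x∉xs a∈xs)
    ... | true | no _ = cong suc (count-remove P xs u a∈xs Pa)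
    ... | false | no _ = count-remove P xs u a∈xs Pa

    count-≟ : {a : A} (xs : List A) → Unique xs → a ∈ xs → count (λ b → does (a ≟ b)) xs ≡ 1
    count-≟ {a} xs u a∈xs = begin
      count (λ b → does (a ≟ b)) xs
        ≡⟨ count-remove (λ b → does (a ≟ b)) xs u a∈xs (dec-true (a ≟ a) refl) ⟩
      suc (count (λ b → does (a ≟ b) ∧ not (does (a ≟ b))) xs)
        ≡⟨ cong suc (count-cong xs (λ b → ∧-inverseʳ (does (a ≟ b)))) ⟩
      suc (count (λ _ → false) xs)
        ≡⟨ cong suc (count-const-false xs) ⟩
      1 ∎
      where open ≡-Reasoning

    does-≟-sym : (a b : A) → does (a ≟ b) ≡ does (b ≟ a)
    does-≟-sym a b with a ≟ b
    ... | yes refl = sym (dec-true (a ≟ a) refl)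
    ... | no a≢b = sym (dec-false (b ≟ a) (λ b≡a → a≢b (sym b≡a)))

  module _ {A : Set} where
    𝔼-uniform-𝟙 : (P : A → Bool) (xs : List A) →
      𝔼 (λ a → 𝟙 (P a)) (uniform xs) ≡ ι (count P xs) * recip (length xs)
    𝔼-uniform-𝟙 P xs = begin
      𝔼 (λ a → 𝟙 (P a)) (uniform xs)                       ≡⟨ 𝔼-uniform (λ a → 𝟙 (P a)) xs ⟩
      recip (length xs) * sumℚ (map (λ a → 𝟙 (P a)) xs)     ≡⟨ cong (recip (length xs) *_) (sum-if P 1ℚ xs) ⟩
      recip (length xs) * (ι (count P xs) * 1ℚ)             ≡⟨ cong (recip (length xs) *_) (*-identityʳ _) ⟩
      recip (length xs) * ι (count P xs)                    ≡⟨ *-comm (recip (length xs)) (ι (count P xs)) ⟩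
      ι (count P xs) * recip (length xs)                    ∎
      where open ≡-Reasoning

module Products where
  open import Defs using (sumℚ; prodℚ)
  open RationalFacts using (ι-nonneg; *-nonneg; ≤1⇒1-nonneg)
  open FiniteExpectation using (𝟙)
  open import Data.Bool using (Bool; true; false; if_then_else_; not)
  open import Data.Bool.ListAction using (all)
  open import Data.Rational using (ℚ; 0ℚ; 1ℚ; _+_; _*_; _-_; _≤_; nonNegative)
  open import Data.Rational.Properties
  open import Data.Rational.Solver using (module +-*-Solver)
  open import Data.List using (List; []; _∷_; map)
  open import Data.List.Relation.Unary.All as All using (All; []; _∷_)
  open import Data.List.Relation.Unary.Unique.Propositional using (Unique)
  open import Data.List.Relation.Unary.AllPairs using ([]; _∷_)
  import Data.List.Membership.DecPropositional as DecMembership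
  open import Data.Product using (_×_; _,_)
  open import Relation.Binary.Definitions using (DecidableEquality)
  open import Relation.Nullary using (yes; no; contradiction)
  open import Relation.Nullary.Decidable using (does; dec-true; dec-false)
  open import Relation.Binary.PropositionalEquality
  open +-*-Solver

  module _ {A : Set} where
    prod-cong-All : {f g : A → ℚ} (xs : List A) → All (λ a → f a ≡ g a) xs → prodℚ (map f xs) ≡ prodℚ (map g xs)
    prod-cong-All [] [] = refl
    prod-cong-All (x ∷ xs) (fx≡gx ∷ eqs) = cong₂ _*_ fx≡gx (prod-cong-All xs eqs)

    prod-cong : {f g : A → ℚ} (xs : List A) → (∀ a → f a ≡ g a) → prodℚ (map f xs) ≡ prodℚ (map g xs)
    prod-cong xs f≗g = prod-cong-All xs (All.tabulate (λ {a} _ → f≗g a))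

    sum-cong-All : {f g : A → ℚ} (xs : List A) → All (λ a → f a ≡ g a) xs → sumℚ (map f xs) ≡ sumℚ (map g xs)
    sum-cong-All [] [] = refl
    sum-cong-All (x ∷ xs) (fx≡gx ∷ eqs) = cong₂ _+_ fx≡gx (sum-cong-All xs eqs)

    sum-cong : {f g : A → ℚ} (xs : List A) → (∀ a → f a ≡ g a) → sumℚ (map f xs) ≡ sumℚ (map g xs)
    sum-cong xs f≗g = sum-cong-All xs (All.tabulate (λ {a} _ → f≗g a))

    prod-*-distrib : (f g : A → ℚ) (xs : List A) →
      prodℚ (map (λ a → f a * g a) xs) ≡ prodℚ (map f xs) * prodℚ (map g xs)
    prod-*-distrib f g [] = refl
    prod-*-distrib f g (x ∷ xs) =
      trans (cong (f x * g x *_) (prod-*-distrib f g xs)) (interchange (f x) (g x) _ _)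
      where
      interchange : ∀ a b c d → a * b * (c * d) ≡ a * c * (b * d)
      interchange = solve 4 (λ a b c d → a :* b :* (c :* d) := a :* c :* (b :* d)) refl

    prod-nonneg : (f : A → ℚ) (xs : List A) → All (λ a → 0ℚ ≤ f a) xs → 0ℚ ≤ prodℚ (map f xs)
    prod-nonneg f [] [] = ι-nonneg 1
    prod-nonneg f (x ∷ xs) (0≤fx ∷ nn) = *-nonneg 0≤fx (prod-nonneg f xs nn)

    sum-nonneg : (f : A → ℚ) (xs : List A) → All (λ a → 0ℚ ≤ f a) xs → 0ℚ ≤ sumℚ (map f xs)
    sum-nonneg f [] [] = ≤-refl
    sum-nonneg f (x ∷ xs) (0≤fx ∷ nn) =
      ≤-trans (≤-reflexive (sym (+-identityˡ 0ℚ))) (+-mono-≤ 0≤fx (sum-nonneg f xs nn))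

    1-sum≤prod-1- : (y : A → ℚ) (xs : List A) → All (λ a → 0ℚ ≤ y a × y a ≤ 1ℚ) xs →
      1ℚ - sumℚ (map y xs) ≤ prodℚ (map (λ a → 1ℚ - y a) xs)
    1-sum≤prod-1- y [] [] = ≤-refl
    1-sum≤prod-1- y (x ∷ xs) ((0≤yx , yx≤1) ∷ bounds) = begin
        1ℚ - (y x + s)
          ≤⟨ ≤-trans (≤-reflexive (sym (+-identityʳ _))) (+-monoʳ-≤ (1ℚ - (y x + s)) 0≤yx*s) ⟩
        1ℚ - (y x + s) + y x * s
          ≡⟨ expand (y x) s ⟩
        (1ℚ - y x) * (1ℚ - s)
          ≤⟨ *-monoˡ-≤-nonNeg (1ℚ - y x) {{nonNegative (≤1⇒1-nonneg yx≤1)}} (1-sum≤prod-1- y xs bounds) ⟩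
        (1ℚ - y x) * prodℚ (map (λ a → 1ℚ - y a) xs) ∎
      where
      open ≤-Reasoning
      s : ℚ
      s = sumℚ (map y xs)
      0≤yx*s : 0ℚ ≤ y x * s
      0≤yx*s = *-nonneg 0≤yx (sum-nonneg y xs (All.map (λ (0≤ya , _) → 0≤ya) bounds))
      expand : ∀ a s → 1ℚ - (a + s) + a * s ≡ (1ℚ - a) * (1ℚ - s)
      expand = solve 2 (λ a s → con 1ℚ :- (a :+ s) :+ a :* s := (con 1ℚ :- a) :* (con 1ℚ :- s)) refl

    𝟙-all : (P : A → Bool) (xs : List A) → 𝟙 (all P xs) ≡ prodℚ (map (λ a → 𝟙 (P a)) xs)
    𝟙-all P [] = refl
    𝟙-all P (x ∷ xs) with P x
    ... | true = trans (𝟙-all P xs) (sym (*-identityˡ (prodℚ (map (λ a → 𝟙 (P a)) xs))))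
    ... | false = sym (*-zeroˡ (prodℚ (map (λ a → 𝟙 (P a)) xs)))

    prod-𝟙-exclusive : (e : A → Bool) → (∀ a b → e a ≡ true → e b ≡ true → a ≡ b) →
      (xs : List A) → Unique xs →
      prodℚ (map (λ a → 𝟙 (not (e a))) xs) ≡ 1ℚ - sumℚ (map (λ a → 𝟙 (e a)) xs)
    prod-𝟙-exclusive e excl [] [] = refl
    prod-𝟙-exclusive e excl (x ∷ xs) (x∉xs ∷ u) with e x in ex
    ... | true = begin
        0ℚ * prodℚ (map (λ a → 𝟙 (not (e a))) xs)   ≡⟨ *-zeroˡ (prodℚ (map (λ a → 𝟙 (not (e a))) xs)) ⟩
        0ℚ                                           ≡⟨ sym (+-inverseʳ 1ℚ) ⟩
        1ℚ - 1ℚ                                      ≡⟨ cong (λ s → 1ℚ - s) (sym (+-identityʳ 1ℚ)) ⟩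
        1ℚ - (1ℚ + 0ℚ)                               ≡⟨ cong (λ s → 1ℚ - (1ℚ + s)) (sym (sum-zero xs x∉xs)) ⟩
        1ℚ - (1ℚ + sumℚ (map (λ a → 𝟙 (e a)) xs))    ∎
      where
      open ≡-Reasoning
      sum-zero : (ys : List A) → All (x ≢_) ys → sumℚ (map (λ a → 𝟙 (e a)) ys) ≡ 0ℚ
      sum-zero [] [] = refl
      sum-zero (y ∷ ys) (x≢y ∷ x∉ys) with e y in ey
      ... | true = contradiction (excl x y ex ey) x≢y
      ... | false = trans (+-identityˡ _) (sum-zero ys x∉ys)
    ... | false = trans (*-identityˡ (prodℚ (map (λ a → 𝟙 (not (e a))) xs)))
                    (trans (prod-𝟙-exclusive e excl xs u)
                           (cong (λ s → 1ℚ - s) (sym (+-identityˡ (sumℚ (map (λ a → 𝟙 (e a)) xs))))))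

  module _ {A : Set} (_≟_ : DecidableEquality A) where
    open DecMembership _≟_ using (_∈?_)

    prod-extract : (g : A → ℚ) (a : A) (xs : List A) → Unique xs →
      prodℚ (map g xs)
        ≡ (if does (a ∈? xs) then g a else 1ℚ) * prodℚ (map (λ b → if does (b ≟ a) then 1ℚ else g b) xs)
    prod-extract g a [] [] = refl
    prod-extract g a (x ∷ xs) (x∉xs ∷ u) with a ≟ x
    ... | yes refl = cong (g a *_) (begin
        prodℚ (map g xs)
          ≡⟨ prod-cong-All xs (All.map unchanged x∉xs) ⟩
        prodℚ (map g′ xs)
          ≡⟨ sym (*-identityˡ (prodℚ (map g′ xs))) ⟩
        1ℚ * prodℚ (map g′ xs)
          ≡⟨ cong (λ d → (if d then 1ℚ else g a) * prodℚ (map g′ xs)) (sym (dec-true (a ≟ a) refl)) ⟩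
        (if does (a ≟ a) then 1ℚ else g a) * prodℚ (map g′ xs) ∎)
      where
      open ≡-Reasoning
      g′ : A → ℚ
      g′ b = if does (b ≟ a) then 1ℚ else g b
      unchanged : ∀ {b} → a ≢ b → g b ≡ g′ b
      unchanged {b} a≢b = sym (cong (λ d → if d then 1ℚ else g b) (dec-false (b ≟ a) (λ b≡a → a≢b (sym b≡a))))
    ... | no a≢x = begin
        g x * prodℚ (map g xs)
          ≡⟨ cong (g x *_) (prod-extract g a xs u) ⟩
        g x * (M * P)
          ≡⟨ swap (g x) M P ⟩
        M * (g x * P)
          ≡⟨ cong (λ d → M * ((if d then 1ℚ else g x) * P)) (sym (dec-false (x ≟ a) (λ x≡a → a≢x (sym x≡a)))) ⟩
        M * ((if does (x ≟ a) then 1ℚ else g x) * P) ∎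
      where
      open ≡-Reasoning
      M P : ℚ
      M = if does (a ∈? xs) then g a else 1ℚ
      P = prodℚ (map (λ b → if does (b ≟ a) then 1ℚ else g b) xs)
      swap : ∀ a b c → a * (b * c) ≡ b * (a * c)
      swap = solve 3 (λ a b c → a :* (b :* c) := b :* (a :* c)) refl

module AlgorithmA (m Δ q : ℕ) where
  open import Defs
  open RationalFacts
  open FiniteExpectation
  open Counting
  open Products
  open import Data.Bool using (Bool; true; false; if_then_else_; not; _∧_; _∨_)
  open import Data.Bool.Properties using (∧-identityʳ; not-¬; T-≡) renaming (_≟_ to _≟ᵇ_)
  open import Data.Bool.ListAction using (all)
  open import Data.Nat as ℕ using (ℕ; suc; _∸_; s≤s)
  import Data.Nat.Properties as ℕP
  open import Data.Rational using (ℚ; 0ℚ; 1ℚ; _+_; _*_; _-_; _≤_; _≤?_; nonNegative)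
  open import Data.Rational.Properties hiding (_≟_)
  open import Data.Fin using (Fin; _≟_)
  open import Data.Fin.Subset using (Subset)
  open import Data.List using (List; []; _∷_; [_]; map; foldr; filter; length; allFin)
  import Data.List.Properties as LP
  open import Data.List.Relation.Unary.All as All using (All; []; _∷_)
  import Data.List.Relation.Unary.All.Properties as All
  open import Data.List.Membership.Propositional using (_∉_)
  open import Data.List.Membership.Propositional.Properties using (∈-allFin)
  import Data.List.Membership.DecPropositional as DecMembership
  open import Data.List.Relation.Unary.Unique.Propositional using (Unique)
  open import Data.List.Relation.Unary.Unique.Propositional.Properties using (allFin⁺)
  open import Data.List.Relation.Unary.AllPairs using ([]; _∷_)
  open import Data.List.Relation.Binary.Sublist.Propositional using (_∷ʳ_; ⊆-refl)
  open import Data.Maybe using (Maybe; just; nothing; is-nothing)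
  import Data.Maybe.Properties as MaybeP
  open import Data.Product using (_×_; _,_; proj₁; proj₂; Σ)
  open import Data.Sum using (_⊎_; inj₁; inj₂)
  open import Relation.Nullary using (Dec; yes; no; contradiction)
  open import Relation.Nullary.Decidable using (does; ⌊_⌋; dec-true; dec-false; toWitness)
  open import Relation.Binary.PropositionalEquality hiding ([_])
  open import Function using (Equivalence; _∘_)

  open DecMembership (_≟_ {m}) using (_∈?_)

  Colour : Set
  Colour = Color m Δ q

  Colouring : Set
  Colouring = StepCol m Δ q

  History : Set
  History = List Colouring

  Arrivals : Set
  Arrivals = List (Subset m)

  edge : Subset m → Fin m → Bool
  edge = adj m Δ q

  degree : Arrivals → Fin m → ℕ
  degree = deg m Δ q

  hasColour : Maybe Colour → Colour → Bool
  hasColour z c = does (MaybeP.≡-dec _≟_ z (just c))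

  free : History → Fin m → Colour → Bool
  free h v c = Z m Δ q c v h

  -- Δ - d_t(v) + q, the number of colours still free at v
  slack : Arrivals → Fin m → ℕ
  slack past v = Δ ∸ degree past v ℕ.+ q

  DegreeBound : Arrivals → Set
  DegreeBound past = ∀ v → degree past v ℕ.≤ Δ

  FreeCount : Arrivals → History → Set
  FreeCount past h = ∀ v → count (free h v) (colors m Δ q) ≡ slack past v

  ColoursFreshly : Subset m → History → Colouring → Set
  ColoursFreshly w h f = ∀ v → (edge w v ≡ true → Σ Colour λ c → f v ≡ just c × free h v c ≡ true)
                             × (edge w v ≡ false → f v ≡ nothing)

  hitProb : Arrivals → Subset m → Fin m → ℚ
  hitProb past w v = if edge w v then recip (slack past v) else 0ℚ

  hitProb-bounds : ∀ past w v → 0ℚ ≤ hitProb past w v × hitProb past w v ≤ 1ℚ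
  hitProb-bounds past w v with edge w v
  ... | true = recip-nonneg (slack past v) , recip-≤1 (slack past v)
  ... | false = ≤-refl , ι-nonneg 1

  degree-∷-edge : ∀ w past {v} → edge w v ≡ true → degree (w ∷ past) v ≡ suc (degree past v)
  degree-∷-edge w past {v} e = cong length (LP.filter-accept (λ u → edge u v ≟ᵇ true) {w} {past} e)

  degree-∷-nonedge : ∀ w past {v} → edge w v ≡ false → degree (w ∷ past) v ≡ degree past v
  degree-∷-nonedge w past {v} e = cong length (LP.filter-reject (λ u → edge u v ≟ᵇ true) {w} {past} (not-¬ e))

  degreeBound-∷ : ∀ w past → DegreeBound (w ∷ past) → DegreeBound past
  degreeBound-∷ w past db v = ℕP.≤-trans (count-mono-⊆ (λ u → edge u v) (w ∷ʳ ⊆-refl)) (db v)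

  slack-∷-edge : ∀ w past {v} → DegreeBound (w ∷ past) → edge w v ≡ true → slack past v ≡ suc (slack (w ∷ past) v)
  slack-∷-edge w past {v} db e = begin
      Δ ∸ degree past v ℕ.+ q             ≡⟨ cong (ℕ._+ q) (ℕP.+-∸-assoc 1 d<Δ) ⟩
      suc (Δ ∸ suc (degree past v) ℕ.+ q) ≡⟨ cong (λ d → suc (Δ ∸ d ℕ.+ q)) (sym (degree-∷-edge w past e)) ⟩
      suc (slack (w ∷ past) v)            ∎
    where
    open ≡-Reasoning
    d<Δ : suc (degree past v) ℕ.≤ Δ
    d<Δ = subst (ℕ._≤ Δ) (degree-∷-edge w past e) (db v)

  slack-∷-nonedge : ∀ w past {v} → edge w v ≡ false → slack (w ∷ past) v ≡ slack past v
  slack-∷-nonedge w past e = cong (λ d → Δ ∸ d ℕ.+ q) (degree-∷-nonedge w past e)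

  slack-pos : 1 ℕ.≤ q → ∀ past v → Σ ℕ λ k → slack past v ≡ suc k
  slack-pos (s≤s {n = q′} _) past v = Δ ∸ degree past v ℕ.+ q′ , ℕP.+-suc (Δ ∸ degree past v) q′

  freeCount-[] : FreeCount [] []
  freeCount-[] v = trans (cong length (LP.filter-all (λ _ → true ≟ᵇ true) {colors m Δ q} (All.tabulate (λ _ → refl))))
                         (LP.length-tabulate (λ c → c))

  freeCount-∷ : ∀ w past h f → DegreeBound (w ∷ past) → FreeCount past h → ColoursFreshly w h f →
    FreeCount (w ∷ past) (f ∷ h)
  freeCount-∷ w past h f db fc fresh v = bool-cases (edge w v) on-edge on-nonedge
    where
    open ≡-Reasoning
    colours : List Colour
    colours = colors m Δ q
    on-edge : edge w v ≡ true → count (free (f ∷ h) v) colours ≡ slack (w ∷ past) v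
    on-edge e = let (c₀ , fv≡c₀ , c₀-free) = proj₁ (fresh v) e in ℕP.suc-injective (begin
        suc (count (free (f ∷ h) v) colours)
          ≡⟨ cong suc (count-cong colours (removes fv≡c₀)) ⟩
        suc (count (λ b → free h v b ∧ not (does (c₀ ≟ b))) colours)
          ≡⟨ sym (count-remove _≟_ (free h v) colours (allFin⁺ _) (∈-allFin c₀) c₀-free) ⟩
        count (free h v) colours
          ≡⟨ fc v ⟩
        slack past v
          ≡⟨ slack-∷-edge w past db e ⟩
        suc (slack (w ∷ past) v) ∎)
      where
      removes : ∀ {c₀} → f v ≡ just c₀ → ∀ b → free (f ∷ h) v b ≡ (free h v b ∧ not (does (c₀ ≟ b)))
      removes {c₀} fv≡c₀ b rewrite fv≡c₀ with does (c₀ ≟ b) | used m Δ q h v b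
      ... | true | true = refl
      ... | true | false = refl
      ... | false | true = refl
      ... | false | false = refl
    on-nonedge : edge w v ≡ false → count (free (f ∷ h) v) colours ≡ slack (w ∷ past) v
    on-nonedge e = trans (count-cong colours unchanged) (trans (fc v) (sym (slack-∷-nonedge w past e)))
      where
      unchanged : ∀ b → free (f ∷ h) v b ≡ free h v b
      unchanged b rewrite proj₂ (fresh v) e = refl

  module FailureMode (w : Subset m) (H : Fin m → Colour → Bool) where
    candidates : Fin m → List Colour
    candidates v = filter (λ c → H v c ≟ᵇ true) (colors m Δ q)

    recolour : Colouring → Fin m → Colour → Colouring
    recolour f v c u = if does (u ≟ v) then just c else f u

    draw : Fin m → Colouring → Dist Colouring
    draw v f = map (λ pc → (proj₁ pc , recolour f v (proj₂ pc))) (uniform (candidates v))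

    -- failureDist w H is failurePrefix (allFin m) by definition
    failurePrefix : List (Fin m) → Dist Colouring
    failurePrefix = foldr (λ v D → if edge w v then bind D (draw v) else D) (return (λ _ → nothing))

    drawn : List (Fin m) → Fin m → Bool
    drawn L v = does (v ∈? L) ∧ edge w v

    drawn-∉ : ∀ {L v} → v ∉ L → drawn L v ≡ false
    drawn-∉ {L} {v} v∉L = cong (_∧ edge w v) (dec-false (v ∈? L) v∉L)

    drawn-∷-nonedge : ∀ {v₀} L → v₀ ∉ L → edge w v₀ ≡ false → ∀ v → drawn (v₀ ∷ L) v ≡ drawn L v
    drawn-∷-nonedge {v₀} L v₀∉L e v with v ≟ v₀
    ... | yes refl = trans e (sym (drawn-∉ v₀∉L))
    ... | no _ = refl

    Assigned : List (Fin m) → Colouring → Set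
    Assigned L f = ∀ u → (drawn L u ≡ true → Σ Colour λ c → f u ≡ just c × H u c ≡ true)
                       × (drawn L u ≡ false → f u ≡ nothing)

    assigned-cong : ∀ {L L′ f} → (∀ u → drawn L u ≡ drawn L′ u) → Assigned L f → Assigned L′ f
    assigned-cong same asg u rewrite sym (same u) = asg u

    failurePrefix-assigned : (L : List (Fin m)) → Unique L → AlmostSurely (Assigned L) (failurePrefix L)
    failurePrefix-assigned [] [] = as-return (λ u → (λ ()) , (λ _ → refl))
    failurePrefix-assigned (v₀ ∷ L) (v₀∉L ∷ uL) with edge w v₀ in e
    ... | false = as-mono (assigned-cong {L} {v₀ ∷ L} (λ u → sym (drawn-∷-nonedge L (All.All¬⇒¬Any v₀∉L) e u)))
                          (failurePrefix-assigned L uL)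
    ... | true = as-bind (failurePrefix L) (draw v₀) (failurePrefix-assigned L uL) drawn-assigned
      where
      drawn-assigned : ∀ f → Assigned L f → AlmostSurely (Assigned (v₀ ∷ L)) (draw v₀ f)
      drawn-assigned f asg = All.map⁺ (All.map⁺ (All.map atom (All.all-filter (λ c → H v₀ c ≟ᵇ true) (colors m Δ q))))
        where
        atom : ∀ {c} → H v₀ c ≡ true →
          AlmostSurelyAt (Assigned (v₀ ∷ L)) (recip (length (candidates v₀)) , recolour f v₀ c)
        atom {c} Hc = recip-nonneg (length (candidates v₀)) , inj₂ assigned
          where
          assigned : Assigned (v₀ ∷ L) (recolour f v₀ c)
          assigned u with u ≟ v₀
          ... | yes refl = (λ _ → c , refl , Hc) , (λ drawn≡false → contradiction (trans (sym e) drawn≡false) (λ ()))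
          ... | no _ = asg u

    marginal : List (Fin m) → (Fin m → Maybe Colour → ℚ) → Fin m → ℚ
    marginal L φ v = if drawn L v then 𝔼 (λ c → φ v (just c)) (uniform (candidates v)) else φ v nothing

    marginal-cong : ∀ {L L′ φ φ′ v} → drawn L v ≡ drawn L′ v → (∀ z → φ v z ≡ φ′ v z) →
      marginal L φ v ≡ marginal L′ φ′ v
    marginal-cong {L} {L′} {φ} {φ′} {v} same φ≗φ′ rewrite same with drawn L′ v
    ... | true = 𝔼-cong (uniform (candidates v)) (λ c → φ≗φ′ (just c))
    ... | false = φ≗φ′ nothing

    Drawable : Set
    Drawable = ∀ v → edge w v ≡ true → 𝔼 (λ _ → 1ℚ) (uniform (candidates v)) ≡ 1ℚ

    -- one more independent draw, at a node v₀ not drawn before, factors out of the expectation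
    module DrawAt {v₀ : Fin m} {L : List (Fin m)} (v₀∉L : v₀ ∉ L) (e : edge w v₀ ≡ true)
                  (vs : List (Fin m)) (uvs : Unique vs) (φ : Fin m → Maybe Colour → ℚ) where
      G : (Fin m → Maybe Colour → ℚ) → Colouring → ℚ
      G ψ f = prodℚ (map (λ v → ψ v (f v)) vs)

      U : Dist Colour
      U = uniform (candidates v₀)

      φ′ : Fin m → Maybe Colour → ℚ
      φ′ v z = if does (v ≟ v₀) then 1ℚ else φ v z

      a : Colour → ℚ
      a c = if does (v₀ ∈? vs) then φ v₀ (just c) else 1ℚ

      A₀ : ℚ
      A₀ = 𝔼 a U

      v₀≟v₀ : does (v₀ ≟ v₀) ≡ true
      v₀≟v₀ = dec-true (v₀ ≟ v₀) refl

      G-recolour : ∀ f c → G φ (recolour f v₀ c) ≡ a c * G φ′ f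
      G-recolour f c = trans (prod-extract _≟_ (λ v → φ v (recolour f v₀ c v)) v₀ vs uvs)
                             (cong₂ _*_ (cong (λ d → a′ (if d then just c else f v₀)) v₀≟v₀) (prod-cong vs pointwise))
        where
        a′ : Maybe Colour → ℚ
        a′ z = if does (v₀ ∈? vs) then φ v₀ z else 1ℚ
        pointwise : ∀ v → (if does (v ≟ v₀) then 1ℚ else φ v (recolour f v₀ c v)) ≡ φ′ v (f v)
        pointwise v with v ≟ v₀
        ... | yes _ = refl
        ... | no _ = refl

      𝔼-draw : ∀ f → 𝔼 (G φ) (draw v₀ f) ≡ A₀ * G φ′ f
      𝔼-draw f = begin
        𝔼 (G φ) (draw v₀ f)
          ≡⟨ 𝔼-map₂ (G φ) (recolour f v₀) U ⟩
        𝔼 (λ c → G φ (recolour f v₀ c)) U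
          ≡⟨ 𝔼-cong U (λ c → trans (G-recolour f c) (*-comm (a c) (G φ′ f))) ⟩
        𝔼 (λ c → G φ′ f * a c) U
          ≡⟨ 𝔼-*ˡ (G φ′ f) a U ⟩
        G φ′ f * A₀
          ≡⟨ *-comm (G φ′ f) A₀ ⟩
        A₀ * G φ′ f ∎
        where open ≡-Reasoning

      v₀-drawn : drawn (v₀ ∷ L) v₀ ≡ true
      v₀-drawn = trans (cong (λ d → (d ∨ does (v₀ ∈? L)) ∧ edge w v₀) v₀≟v₀) e

      extracted-factor : Drawable → (if does (v₀ ∈? vs) then marginal (v₀ ∷ L) φ v₀ else 1ℚ) ≡ A₀
      extracted-factor dr rewrite v₀-drawn with does (v₀ ∈? vs)
      ... | true = refl
      ... | false = sym (dr v₀ e)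

      remaining-factor : ∀ v → (if does (v ≟ v₀) then 1ℚ else marginal (v₀ ∷ L) φ v) ≡ marginal L φ′ v
      remaining-factor v with v ≟ v₀
      ... | yes refl = sym (cong (λ b → if b then _ else 1ℚ) (drawn-∉ v₀∉L))
      ... | no _ = refl

    𝔼-failurePrefix-prod : Drawable → (L : List (Fin m)) → Unique L → (vs : List (Fin m)) → Unique vs →
      (φ : Fin m → Maybe Colour → ℚ) →
      𝔼 (λ f → prodℚ (map (λ v → φ v (f v)) vs)) (failurePrefix L) ≡ prodℚ (map (marginal L φ) vs)
    𝔼-failurePrefix-prod dr [] [] vs uvs φ = trans (+-identityʳ _) (*-identityˡ _)
    𝔼-failurePrefix-prod dr (v₀ ∷ L) (v₀∉L ∷ uL) vs uvs φ with edge w v₀ in e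
    ... | false = trans (𝔼-failurePrefix-prod dr L uL vs uvs φ)
                        (prod-cong vs (λ v → marginal-cong {L} {v₀ ∷ L} {φ} {φ} (undrawn v) (λ _ → refl)))
      where
      undrawn : ∀ v → drawn L v ≡ drawn (v₀ ∷ L) v
      undrawn v = sym (drawn-∷-nonedge L (All.All¬⇒¬Any v₀∉L) e v)
    ... | true = begin
        𝔼 (G φ) (bind (failurePrefix L) (draw v₀))
          ≡⟨ 𝔼-bind (G φ) (failurePrefix L) (draw v₀) ⟩
        𝔼 (λ f → 𝔼 (G φ) (draw v₀ f)) (failurePrefix L)
          ≡⟨ 𝔼-cong (failurePrefix L) 𝔼-draw ⟩
        𝔼 (λ f → A₀ * G φ′ f) (failurePrefix L)
          ≡⟨ 𝔼-*ˡ A₀ (G φ′) (failurePrefix L) ⟩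
        A₀ * 𝔼 (G φ′) (failurePrefix L)
          ≡⟨ cong (A₀ *_) (𝔼-failurePrefix-prod dr L uL vs uvs φ′) ⟩
        A₀ * prodℚ (map (marginal L φ′) vs)
          ≡⟨ cong₂ _*_ (sym (extracted-factor dr)) (prod-cong vs (λ v → sym (remaining-factor v))) ⟩
        (if does (v₀ ∈? vs) then marginal (v₀ ∷ L) φ v₀ else 1ℚ)
          * prodℚ (map (λ v → if does (v ≟ v₀) then 1ℚ else marginal (v₀ ∷ L) φ v) vs)
          ≡⟨ sym (prod-extract _≟_ (marginal (v₀ ∷ L) φ) v₀ vs uvs) ⟩
        prodℚ (map (marginal (v₀ ∷ L) φ) vs) ∎
      where
      open ≡-Reasoning
      open DrawAt (All.All¬⇒¬Any v₀∉L) e vs uvs φ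

  avoids : Colour → List (Fin m) → Colouring → ℚ
  avoids c vs f = prodℚ (map (λ v → 𝟙 (not (hasColour (f v) c))) vs)

  AvoidanceLaw : Arrivals → Subset m → Colour → List (Fin m) → Dist Colouring → Set
  AvoidanceLaw past w c vs D = 𝔼 (avoids c vs) D ≡ 1ℚ - sumℚ (map (hitProb past w) vs)
                             ⊎ 𝔼 (avoids c vs) D ≡ prodℚ (map (λ v → 1ℚ - hitProb past w v) vs)

  𝟙-unassigned : ∀ z → 𝟙 (is-nothing z) ≡ 1ℚ - sumℚ (map (λ c → 𝟙 (hasColour z c)) (colors m Δ q))
  𝟙-unassigned z = sym (trans (cong (λ s → 1ℚ - s) (sum-if (hasColour z) 1ℚ (colors m Δ q))) (by-value z))
    where
    by-value : ∀ z → 1ℚ - ι (count (hasColour z) (colors m Δ q)) * 1ℚ ≡ 𝟙 (is-nothing z)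
    by-value nothing rewrite count-const-false (colors m Δ q) = refl
    by-value (just c₀) rewrite count-≟ _≟_ (colors m Δ q) (allFin⁺ _) (∈-allFin c₀) = refl

  module Step (S : Sampler m Δ q) (VS : ValidSampler m Δ q S) (q≥1 : 1 ℕ.≤ q)
              (past : Arrivals) (h : History) (w : Subset m) (fc : FreeCount past h) where
    -- H_t, x^t and the mode test exactly as in step, which therefore unfolds to the conditional of step-cases
    H : Fin m → Colour → Bool
    H v c = edge w v ∧ free h v c

    x : Fin m → Colour → ℚ
    x v c = if H v c then recip (slack past v) else 0ℚ

    matchingMode : Bool
    matchingMode = all (λ c → ⌊ sumℚ (map (λ v → x v c) (allFin m)) ≤? 1ℚ ⌋) (colors m Δ q)

    step-cases : (P : Dist Colouring → Set) → (matchingMode ≡ true → P (S w H x)) → P (failureDist m Δ q w H) →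
      P (step m Δ q S past h w)
    step-cases P on-matching on-failure = by-mode matchingMode refl
      where
      by-mode : (b : Bool) → matchingMode ≡ b → P (if b then S w H x else failureDist m Δ q w H)
      by-mode true mm = on-matching mm
      by-mode false _ = on-failure

    open FailureMode w H

    count-H : ∀ v → edge w v ≡ true → count (H v) (colors m Δ q) ≡ slack past v
    count-H v e = trans (count-cong (colors m Δ q) (λ c → cong (_∧ free h v c) e)) (fc v)

    x-free : ∀ {v c} → free h v c ≡ true → x v c ≡ hitProb past w v
    x-free {v} fr with edge w v
    ... | true rewrite fr = refl
    ... | false = refl

    module Matching (mm : matchingMode ≡ true) where
      rowSum : ∀ v → sumℚ (map (λ c → x v c) (colors m Δ q)) ≡ ι (count (H v) (colors m Δ q)) * recip (slack past v)
      rowSum v = sum-if (H v) (recip (slack past v)) (colors m Δ q)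

      rowSum-edge : ∀ v → edge w v ≡ true → sumℚ (map (λ c → x v c) (colors m Δ q)) ≡ 1ℚ
      rowSum-edge v e = let (k , slack≡) = slack-pos q≥1 past v in begin
        sumℚ (map (λ c → x v c) (colors m Δ q))
          ≡⟨ rowSum v ⟩
        ι (count (H v) (colors m Δ q)) * recip (slack past v)
          ≡⟨ cong (λ n → ι n * recip (slack past v)) (count-H v e) ⟩
        ι (slack past v) * recip (slack past v)
          ≡⟨ cong (λ n → ι n * recip n) slack≡ ⟩
        ι (suc k) * recip (suc k)
          ≡⟨ ι-*-recip k ⟩
        1ℚ ∎
        where open ≡-Reasoning

      rowSum-nonedge : ∀ v → edge w v ≡ false → sumℚ (map (λ c → x v c) (colors m Δ q)) ≡ 0ℚ
      rowSum-nonedge v e =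
        trans (rowSum v) (trans (cong (λ n → ι n * recip (slack past v)) count≡0) (*-zeroˡ (recip (slack past v))))
        where
        count≡0 : count (H v) (colors m Δ q) ≡ 0
        count≡0 = trans (count-cong (colors m Δ q) (λ c → cong (_∧ free h v c) e)) (count-const-false (colors m Δ q))

      admissible : AdmissibleX m Δ q w H x
      admissible = x-nonneg , outside , columns , rows
        where
        x-nonneg : ∀ v c → 0ℚ ≤ x v c
        x-nonneg v c with H v c
        ... | true = recip-nonneg (slack past v)
        ... | false = ≤-refl
        outside : ∀ v c → (edge w v ∧ H v c) ≡ false → x v c ≡ 0ℚ
        outside v c e with edge w v | free h v c
        ... | true | false = refl
        ... | false | _ = refl
        columns : ∀ c → sumℚ (map (λ v → x v c) (allFin m)) ≤ 1ℚ
        columns c = toWitness (Equivalence.from T-≡ (all-true-lookup column-ok mm (∈-allFin c)))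
          where
          column-ok : Colour → Bool
          column-ok c = ⌊ sumℚ (map (λ v → x v c) (allFin m)) ≤? 1ℚ ⌋
        rows : ∀ v → sumℚ (map (λ c → x v c) (colors m Δ q)) ≤ 1ℚ
        rows v = bool-cases (edge w v) (λ e → ≤-reflexive (rowSum-edge v e))
                                       (λ e → ≤-trans (≤-reflexive (rowSum-nonedge v e)) (ι-nonneg 1))

      sampled : IsDist (S w H x) × All (λ pf → IsMatching m Δ q w H (proj₂ pf)) (S w H x)
              × (∀ v c → Pr (λ f → hasColour (f v) c) (S w H x) ≡ x v c)
      sampled = VS w H x admissible

      nonneg : NonNegWeights (S w H x)
      nonneg = proj₁ (proj₁ sampled)

      matchings : All (λ pf → IsMatching m Δ q w H (proj₂ pf)) (S w H x)
      matchings = proj₁ (proj₂ sampled)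

      mass : 𝔼 (λ _ → 1ℚ) (S w H x) ≡ 1ℚ
      mass = trans (𝔼-1 (S w H x)) (proj₂ (proj₁ sampled))

      𝔼-hasColour : ∀ v c → 𝔼 (λ f → 𝟙 (hasColour (f v) c)) (S w H x) ≡ x v c
      𝔼-hasColour v c = trans (sym (Pr-as-𝔼 _ (S w H x))) (proj₂ (proj₂ sampled) v c)

      𝔼-1-sum : {I : Set} (is : List I) (g : I → Colouring → ℚ) →
        𝔼 (λ f → 1ℚ - sumℚ (map (λ i → g i f) is)) (S w H x) ≡ 1ℚ - sumℚ (map (λ i → 𝔼 (g i) (S w H x)) is)
      𝔼-1-sum is g = trans (𝔼-- _ _ (S w H x)) (cong₂ _-_ mass (𝔼-sum is g (S w H x)))

      -- a colour is matched to at most one node, so avoiding it is complementary to hitting it somewhere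
      avoid-matching : ∀ c vs → Unique vs → All (λ v → free h v c ≡ true) vs →
        𝔼 (avoids c vs) (S w H x) ≡ 1ℚ - sumℚ (map (hitProb past w) vs)
      avoid-matching c vs uvs frees = begin
        𝔼 (avoids c vs) (S w H x)
          ≡⟨ 𝔼-cong-weighted (S w H x) (All.map (λ {pf} → cong (proj₁ pf *_) ∘ exclusive (proj₂ pf)) matchings) ⟩
        𝔼 (λ f → 1ℚ - sumℚ (map (λ v → 𝟙 (hasColour (f v) c)) vs)) (S w H x)
          ≡⟨ 𝔼-1-sum vs (λ v f → 𝟙 (hasColour (f v) c)) ⟩
        1ℚ - sumℚ (map (λ v → 𝔼 (λ f → 𝟙 (hasColour (f v) c)) (S w H x)) vs)
          ≡⟨ cong (λ s → 1ℚ - s) (sum-cong-All vs (All.map (λ {v} fr → trans (𝔼-hasColour v c) (x-free fr)) frees)) ⟩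
        1ℚ - sumℚ (map (hitProb past w) vs) ∎
        where
        open ≡-Reasoning
        exclusive : ∀ f → IsMatching m Δ q w H f → avoids c vs f ≡ 1ℚ - sumℚ (map (λ v → 𝟙 (hasColour (f v) c)) vs)
        exclusive f (_ , injective) = prod-𝟙-exclusive (λ v → hasColour (f v) c) at-most-one vs uvs
          where
          at-most-one : ∀ v v′ → hasColour (f v) c ≡ true → hasColour (f v′) c ≡ true → v ≡ v′
          at-most-one v v′ hv hv′ =
            injective v v′ c (does⇒ (MaybeP.≡-dec _≟_ (f v) (just c)) hv) (does⇒ (MaybeP.≡-dec _≟_ (f v′) (just c)) hv′)

      unassigned-null : ∀ v → edge w v ≡ true → 𝔼 (λ f → 𝟙 (is-nothing (f v))) (S w H x) ≡ 0ℚ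
      unassigned-null v e = begin
        𝔼 (λ f → 𝟙 (is-nothing (f v))) (S w H x)
          ≡⟨ 𝔼-cong (S w H x) (λ f → 𝟙-unassigned (f v)) ⟩
        𝔼 (λ f → 1ℚ - sumℚ (map (λ c → 𝟙 (hasColour (f v) c)) (colors m Δ q))) (S w H x)
          ≡⟨ 𝔼-1-sum (colors m Δ q) (λ c f → 𝟙 (hasColour (f v) c)) ⟩
        1ℚ - sumℚ (map (λ c → 𝔼 (λ f → 𝟙 (hasColour (f v) c)) (S w H x)) (colors m Δ q))
          ≡⟨ cong (λ s → 1ℚ - s) (sum-cong (colors m Δ q) (𝔼-hasColour v)) ⟩
        1ℚ - sumℚ (map (λ c → x v c) (colors m Δ q))
          ≡⟨ cong (λ s → 1ℚ - s) (rowSum-edge v e) ⟩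
        1ℚ - 1ℚ
          ≡⟨ +-inverseʳ 1ℚ ⟩
        0ℚ ∎
        where open ≡-Reasoning

      fresh-matching : AlmostSurely (ColoursFreshly w h) (S w H x)
      fresh-matching = as-mono (λ (assigned , matching) → fresh assigned matching)
                               (as-All (as-∀ (S w H x) nonneg per-node) matchings)
        where
        per-node : ∀ v → AlmostSurely (λ f → edge w v ≡ true → is-nothing (f v) ≡ false) (S w H x)
        per-node v = bool-cases (edge w v)
          (λ e → as-mono (λ nn _ → nn) (as-of-𝔼-𝟙≡0 (λ f → is-nothing (f v)) (S w H x) nonneg (unassigned-null v e)))
          (λ e → as-always (S w H x) nonneg (λ _ e′ → contradiction (trans (sym e) e′) λ ()))
        fresh : ∀ {f} → (∀ v → edge w v ≡ true → is-nothing (f v) ≡ false) → IsMatching m Δ q w H f →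
          ColoursFreshly w h f
        fresh {f} assigned (edges , _) v with f v in fv
        ... | just c = (λ _ → c , refl , ∧-true-right (proj₂ (edges v c fv)))
                     , (λ e → contradiction (trans (sym (proj₁ (edges v c fv))) e) λ ())
        ... | nothing = (λ e → contradiction (trans (sym (cong is-nothing fv)) (assigned v e)) λ ()) , (λ _ → refl)

    drawable : Drawable
    drawable v e = let (k , slack≡) = slack-pos q≥1 past v in uniform-mass (candidates v) (trans (count-H v e) slack≡)

    drawn-allFin : ∀ v → drawn (allFin m) v ≡ edge w v
    drawn-allFin v = cong (_∧ edge w v) (dec-true (v ∈? allFin m) (∈-allFin v))

    fresh-failure : AlmostSurely (ColoursFreshly w h) (failureDist m Δ q w H)
    fresh-failure = as-mono fresh (failurePrefix-assigned (allFin m) (allFin⁺ m))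
      where
      fresh : ∀ {f} → Assigned (allFin m) f → ColoursFreshly w h f
      fresh asg v = (λ e → let (c , fv≡c , Hc) = proj₁ (asg v) (trans (drawn-allFin v) e) in c , fv≡c , ∧-true-right Hc)
                  , (λ e → proj₂ (asg v) (trans (drawn-allFin v) e))

    -- a uniformly random free colour of v misses c in all but one of its slack(v) choices
    avoid-failure : ∀ c vs → Unique vs → All (λ v → free h v c ≡ true) vs →
      𝔼 (avoids c vs) (failureDist m Δ q w H) ≡ prodℚ (map (λ v → 1ℚ - hitProb past w v) vs)
    avoid-failure c vs uvs frees =
      trans (𝔼-failurePrefix-prod drawable (allFin m) (allFin⁺ m) vs uvs φ) (prod-cong-All vs (All.map marginal-avoid frees))
      where
      φ : Fin m → Maybe Colour → ℚ
      φ v z = 𝟙 (not (hasColour z c))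
      marginal-avoid : ∀ {v} → free h v c ≡ true → marginal (allFin m) φ v ≡ 1ℚ - hitProb past w v
      marginal-avoid {v} fr rewrite drawn-allFin v with edge w v
      ... | false = refl
      ... | true = let (k , slack≡) = slack-pos q≥1 past v in begin
          𝔼 (λ c′ → 𝟙 (not (does (c′ ≟ c)))) (uniform freeColours)
            ≡⟨ 𝔼-uniform-𝟙 (λ c′ → not (does (c′ ≟ c))) freeColours ⟩
          ι (count (λ c′ → not (does (c′ ≟ c))) freeColours) * recip (length freeColours)
            ≡⟨ cong₂ (λ a b → ι a * recip b) (others k slack≡) (trans (fc v) slack≡) ⟩
          ι k * recip (suc k)
            ≡⟨ ι-*-recip-suc k ⟩
          1ℚ - recip (suc k)
            ≡⟨ cong (λ n → 1ℚ - recip n) (sym slack≡) ⟩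
          1ℚ - recip (slack past v) ∎
        where
        open ≡-Reasoning
        -- candidates v, now that edge w v has been abstracted to true
        freeColours : List Colour
        freeColours = filter (λ c′ → free h v c′ ≟ᵇ true) (colors m Δ q)
        others : ∀ k → slack past v ≡ suc k → count (λ c′ → not (does (c′ ≟ c))) freeColours ≡ k
        others k slack≡ = ℕP.suc-injective (begin
          suc (count (λ c′ → not (does (c′ ≟ c))) freeColours)
            ≡⟨ cong suc (count-filter (free h v) _ (colors m Δ q)) ⟩
          suc (count (λ c′ → free h v c′ ∧ not (does (c′ ≟ c))) (colors m Δ q))
            ≡⟨ cong suc (count-cong (colors m Δ q) (λ c′ → cong (λ d → free h v c′ ∧ not d) (does-≟-sym _≟_ c′ c))) ⟩
          suc (count (λ c′ → free h v c′ ∧ not (does (c ≟ c′))) (colors m Δ q))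
            ≡⟨ sym (count-remove _≟_ (free h v) (colors m Δ q) (allFin⁺ _) (∈-allFin c) fr) ⟩
          count (free h v) (colors m Δ q)
            ≡⟨ fc v ⟩
          slack past v
            ≡⟨ slack≡ ⟩
          suc k ∎)

    step-fresh : AlmostSurely (ColoursFreshly w h) (step m Δ q S past h w)
    step-fresh = step-cases (AlmostSurely (ColoursFreshly w h)) Matching.fresh-matching fresh-failure

    step-avoid : ∀ c vs → Unique vs → All (λ v → free h v c ≡ true) vs →
      AvoidanceLaw past w c vs (step m Δ q S past h w)
    step-avoid c vs uvs frees = step-cases (AvoidanceLaw past w c vs)
                                           (λ mm → inj₁ (Matching.avoid-matching mm c vs uvs frees))
                                           (inj₂ (avoid-failure c vs uvs frees))

    step-avoid-≤ : ∀ c vs → Unique vs → All (λ v → free h v c ≡ true) vs →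
      𝔼 (avoids c vs) (step m Δ q S past h w) ≤ prodℚ (map (λ v → 1ℚ - hitProb past w v) vs)
    step-avoid-≤ c vs uvs frees with step-avoid c vs uvs frees
    ... | inj₁ E≡ = ≤-trans (≤-reflexive E≡)
                            (1-sum≤prod-1- (hitProb past w) vs (All.tabulate (λ {v} _ → hitProb-bounds past w v)))
    ... | inj₂ E≡ = ≤-reflexive E≡

    step-avoid-single : ∀ c v → free h v c ≡ true →
      𝔼 (avoids c (v ∷ [])) (step m Δ q S past h w) ≡ 1ℚ - hitProb past w v
    step-avoid-single c v fr with step-avoid c (v ∷ []) ([] ∷ []) (fr ∷ [])
    ... | inj₁ E≡ = trans E≡ (cong (λ s → 1ℚ - s) (+-identityʳ (hitProb past w v)))
    ... | inj₂ E≡ = trans E≡ (*-identityʳ (1ℚ - hitProb past w v))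

  𝟙-not-∨ : ∀ a b → 𝟙 (not (a ∨ b)) ≡ 𝟙 (not b) * 𝟙 (not a)
  𝟙-not-∨ true true = refl
  𝟙-not-∨ true false = refl
  𝟙-not-∨ false true = refl
  𝟙-not-∨ false false = refl

  𝟙-allZ-∷ : ∀ c vs f h → 𝟙 (allZ m Δ q c vs (f ∷ h)) ≡ 𝟙 (allZ m Δ q c vs h) * avoids c vs f
  𝟙-allZ-∷ c vs f h = begin
    𝟙 (allZ m Δ q c vs (f ∷ h))
      ≡⟨ 𝟙-all _ vs ⟩
    prodℚ (map (λ v → 𝟙 (not (hasColour (f v) c ∨ used m Δ q h v c))) vs)
      ≡⟨ prod-cong vs (λ v → 𝟙-not-∨ (hasColour (f v) c) (used m Δ q h v c)) ⟩
    prodℚ (map (λ v → 𝟙 (free h v c) * 𝟙 (not (hasColour (f v) c))) vs)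
      ≡⟨ prod-*-distrib _ _ vs ⟩
    prodℚ (map (λ v → 𝟙 (free h v c)) vs) * avoids c vs f
      ≡⟨ cong (_* avoids c vs f) (sym (𝟙-all _ vs)) ⟩
    𝟙 (allZ m Δ q c vs h) * avoids c vs f ∎
    where open ≡-Reasoning

  allZ-free : ∀ c vs h → allZ m Δ q c vs h ≡ true → All (λ v → free h v c ≡ true) vs
  allZ-free c vs h all≡true = All.tabulate (all-true-lookup (λ v → free h v c) all≡true)

  module Run (S : Sampler m Δ q) (VS : ValidSampler m Δ q S) (q≥1 : 1 ℕ.≤ q) where
    run : Arrivals → Dist History
    run = runRev m Δ q S

    run-freeCount : ∀ past → DegreeBound past → AlmostSurely (FreeCount past) (run past)
    run-freeCount [] _ = as-return freeCount-[]
    run-freeCount (w ∷ past) db = as-bind (run past) _ (run-freeCount past (degreeBound-∷ w past db)) extend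
      where
      extend : ∀ h → FreeCount past h → AlmostSurely (FreeCount (w ∷ past)) _
      extend h fc = as-map₂ (_∷ h) (step m Δ q S past h w) (Step.step-fresh S VS q≥1 past h w fc)
                            (λ f → freeCount-∷ w past h f db fc)

    Pr-allZ-∷ : ∀ c vs w past → Pr (allZ m Δ q c vs) (run (w ∷ past))
      ≡ 𝔼 (λ h → 𝟙 (allZ m Δ q c vs h) * 𝔼 (avoids c vs) (step m Δ q S past h w)) (run past)
    Pr-allZ-∷ c vs w past = begin
      Pr (allZ m Δ q c vs) (run (w ∷ past))
        ≡⟨ Pr-as-𝔼 _ (run (w ∷ past)) ⟩
      𝔼 (λ h → 𝟙 (allZ m Δ q c vs h)) (run (w ∷ past))
        ≡⟨ 𝔼-bind _ (run past) _ ⟩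
      𝔼 (λ h → 𝔼 (λ h′ → 𝟙 (allZ m Δ q c vs h′)) (map _ (step m Δ q S past h w))) (run past)
        ≡⟨ 𝔼-cong (run past) one-step ⟩
      𝔼 (λ h → 𝟙 (allZ m Δ q c vs h) * 𝔼 (avoids c vs) (step m Δ q S past h w)) (run past) ∎
      where
      open ≡-Reasoning
      one-step : ∀ h → 𝔼 (λ h′ → 𝟙 (allZ m Δ q c vs h′)) (map (λ pf → (proj₁ pf , proj₂ pf ∷ h)) (step m Δ q S past h w))
                     ≡ 𝟙 (allZ m Δ q c vs h) * 𝔼 (avoids c vs) (step m Δ q S past h w)
      one-step h = trans (𝔼-map₂ _ (_∷ h) D)
                         (trans (𝔼-cong D (λ f → 𝟙-allZ-∷ c vs f h)) (𝔼-*ˡ (𝟙 (allZ m Δ q c vs h)) (avoids c vs) D))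
        where
        D : Dist Colouring
        D = step m Δ q S past h w

    Pr-Z-as-allZ : ∀ c v D → Pr (Z m Δ q c v) D ≡ Pr (allZ m Δ q c (v ∷ [])) D
    Pr-Z-as-allZ c v D = trans (Pr-as-𝔼 _ D)
      (trans (𝔼-cong D (λ h → cong 𝟙 (sym (∧-identityʳ (Z m Δ q c v h))))) (sym (Pr-as-𝔼 _ D)))

    Pr-Z-∷ : ∀ c v w past → DegreeBound (w ∷ past) →
      Pr (Z m Δ q c v) (run (w ∷ past)) ≡ (1ℚ - hitProb past w v) * Pr (Z m Δ q c v) (run past)
    Pr-Z-∷ c v w past db = begin
      Pr (Z m Δ q c v) (run (w ∷ past))
        ≡⟨ Pr-Z-as-allZ c v (run (w ∷ past)) ⟩
      Pr (allZ m Δ q c [ v ]) (run (w ∷ past))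
        ≡⟨ Pr-allZ-∷ c [ v ] w past ⟩
      𝔼 (λ h → 𝟙 (allZ m Δ q c [ v ] h) * 𝔼 (avoids c [ v ]) (step m Δ q S past h w)) (run past)
        ≡⟨ as-𝔼-cong (run past) (run-freeCount past (degreeBound-∷ w past db)) survive ⟩
      𝔼 (λ h → 𝟙 (allZ m Δ q c [ v ] h) * (1ℚ - hitProb past w v)) (run past)
        ≡⟨ 𝔼-𝟙-* (allZ m Δ q c [ v ]) (1ℚ - hitProb past w v) (run past) ⟩
      (1ℚ - hitProb past w v) * Pr (allZ m Δ q c [ v ]) (run past)
        ≡⟨ cong ((1ℚ - hitProb past w v) *_) (sym (Pr-Z-as-allZ c v (run past))) ⟩
      (1ℚ - hitProb past w v) * Pr (Z m Δ q c v) (run past) ∎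
      where
      open ≡-Reasoning
      survive : ∀ h → FreeCount past h →
        𝟙 (allZ m Δ q c [ v ] h) * 𝔼 (avoids c [ v ]) (step m Δ q S past h w)
          ≡ 𝟙 (allZ m Δ q c [ v ] h) * (1ℚ - hitProb past w v)
      survive h fc = 𝟙-*-cong (λ all≡true →
        Step.step-avoid-single S VS q≥1 past h w fc c v (All.head (allZ-free c [ v ] h all≡true)))

    Pr-Z : ∀ c v past → DegreeBound past → Pr (Z m Δ q c v) (run past) ≡ frac (slack past v) (Δ ℕ.+ q)
    Pr-Z c v [] _ = let (k , slack≡) = slack-pos q≥1 [] v in sym (trans (cong (λ n → ι n * recip n) slack≡) (ι-*-recip k))
    Pr-Z c v (w ∷ past) db = begin
      Pr (Z m Δ q c v) (run (w ∷ past))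
        ≡⟨ Pr-Z-∷ c v w past db ⟩
      (1ℚ - hitProb past w v) * Pr (Z m Δ q c v) (run past)
        ≡⟨ cong ((1ℚ - hitProb past w v) *_) (Pr-Z c v past (degreeBound-∷ w past db)) ⟩
      (1ℚ - hitProb past w v) * (ι (slack past v) * recip (Δ ℕ.+ q))
        ≡⟨ bool-cases (edge w v) on-edge on-nonedge ⟩
      ι (slack (w ∷ past) v) * recip (Δ ℕ.+ q) ∎
      where
      open ≡-Reasoning
      r : ℚ
      r = recip (Δ ℕ.+ q)
      on-edge : edge w v ≡ true → (1ℚ - hitProb past w v) * (ι (slack past v) * r) ≡ ι (slack (w ∷ past) v) * r
      on-edge e = begin
        (1ℚ - hitProb past w v) * (ι (slack past v) * r)
          ≡⟨ cong (λ p → (1ℚ - p) * (ι (slack past v) * r)) (cong (λ b → if b then recip (slack past v) else 0ℚ) e) ⟩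
        (1ℚ - recip (slack past v)) * (ι (slack past v) * r)
          ≡⟨ cong (λ n → (1ℚ - recip n) * (ι n * r)) (slack-∷-edge w past db e) ⟩
        (1ℚ - recip (suc (slack (w ∷ past) v))) * (ι (suc (slack (w ∷ past) v)) * r)
          ≡⟨ 1-recip-*-ι (slack (w ∷ past) v) r ⟩
        ι (slack (w ∷ past) v) * r ∎
      on-nonedge : edge w v ≡ false → (1ℚ - hitProb past w v) * (ι (slack past v) * r) ≡ ι (slack (w ∷ past) v) * r
      on-nonedge e = begin
        (1ℚ - hitProb past w v) * (ι (slack past v) * r)
          ≡⟨ cong (λ p → (1ℚ - p) * (ι (slack past v) * r)) (cong (λ b → if b then recip (slack past v) else 0ℚ) e) ⟩
        1ℚ * (ι (slack past v) * r)
          ≡⟨ *-identityˡ _ ⟩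
        ι (slack past v) * r
          ≡⟨ cong (λ n → ι n * r) (sym (slack-∷-nonedge w past e)) ⟩
        ι (slack (w ∷ past) v) * r ∎

    Pr-allZ-≤ : ∀ c past → DegreeBound past → ∀ vs → Unique vs →
      Pr (allZ m Δ q c vs) (run past) ≤ prodℚ (map (λ v → Pr (Z m Δ q c v) (run past)) vs)
    Pr-allZ-≤ c [] _ vs _ = ≤-reflexive (trans (cong (λ b → 𝟙 b + 0ℚ) (allZ-[] vs)) (sym (prod-1 vs)))
      where
      allZ-[] : ∀ vs → allZ m Δ q c vs [] ≡ true
      allZ-[] [] = refl
      allZ-[] (_ ∷ vs) = allZ-[] vs
      prod-1 : ∀ vs → prodℚ (map (λ v → Pr (Z m Δ q c v) (run [])) vs) ≡ 1ℚ
      prod-1 [] = refl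
      prod-1 (_ ∷ vs) = cong (1ℚ *_) (prod-1 vs)
    Pr-allZ-≤ c (w ∷ past) db vs uvs = begin
      Pr (allZ m Δ q c vs) (run (w ∷ past))
        ≡⟨ Pr-allZ-∷ c vs w past ⟩
      𝔼 (λ h → 𝟙 (allZ m Δ q c vs h) * 𝔼 (avoids c vs) (step m Δ q S past h w)) (run past)
        ≤⟨ as-𝔼-mono (run past) (run-freeCount past db′) survive ⟩
      𝔼 (λ h → 𝟙 (allZ m Δ q c vs h) * Π) (run past)
        ≡⟨ 𝔼-𝟙-* (allZ m Δ q c vs) Π (run past) ⟩
      Π * Pr (allZ m Δ q c vs) (run past)
        ≤⟨ *-monoˡ-≤-nonNeg Π {{nonNegative 0≤Π}} (Pr-allZ-≤ c past db′ vs uvs) ⟩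
      Π * prodℚ (map (λ v → Pr (Z m Δ q c v) (run past)) vs)
        ≡⟨ sym (prod-*-distrib _ _ vs) ⟩
      prodℚ (map (λ v → (1ℚ - hitProb past w v) * Pr (Z m Δ q c v) (run past)) vs)
        ≡⟨ prod-cong vs (λ v → sym (Pr-Z-∷ c v w past db)) ⟩
      prodℚ (map (λ v → Pr (Z m Δ q c v) (run (w ∷ past))) vs) ∎
      where
      open ≤-Reasoning
      db′ : DegreeBound past
      db′ = degreeBound-∷ w past db
      Π : ℚ
      Π = prodℚ (map (λ v → 1ℚ - hitProb past w v) vs)
      0≤Π : 0ℚ ≤ Π
      0≤Π = prod-nonneg _ vs (All.tabulate (λ {v} _ → ≤1⇒1-nonneg (proj₂ (hitProb-bounds past w v))))
      survive : ∀ h → FreeCount past h →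
        𝟙 (allZ m Δ q c vs h) * 𝔼 (avoids c vs) (step m Δ q S past h w) ≤ 𝟙 (allZ m Δ q c vs h) * Π
      survive h fc = 𝟙-*-mono (λ all≡true →
        Step.step-avoid-≤ S VS q≥1 past h w fc c vs uvs (allZ-free c vs h all≡true))

open import Defs
open import Data.Nat using (_≤_; _<_; _+_; _∸_)
open import Data.Nat.Properties using (≤-trans; ≤-reflexive)
open import Data.Rational using () renaming (_≤_ to _≤ℚ_)
open import Data.Fin using (Fin)
open import Data.Fin.Subset using (Subset)
open import Data.List using (List; length; map; take; reverse)
open import Data.List.Relation.Unary.Unique.Propositional using (Unique)
open import Data.List.Relation.Binary.Sublist.Propositional.Properties using (take-⊆)
open import Data.Product using (_×_; _,_)
open import Relation.Binary.PropositionalEquality using (_≡_; trans; cong)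
open Counting using (count-reverse; count-mono-⊆)

lemma1 : (m Δ q : ℕ) → 1 ≤ q → (ws : List (Subset m)) → MaxDegree m Δ q ws →
  (S : Sampler m Δ q) → ValidSampler m Δ q S →
  (t : ℕ) → t < length ws →
  ((c : Color m Δ q) (v : Fin m) →
    Pr (Z m Δ q c v) (histAt m Δ q S ws t) ≡ frac (Δ ∸ dAt m Δ q ws t v + q) (Δ + q))
  × ((c : Color m Δ q) (vs : List (Fin m)) → Unique vs →
    Pr (allZ m Δ q c vs) (histAt m Δ q S ws t)
      ≤ℚ prodℚ (map (λ v → Pr (Z m Δ q c v) (histAt m Δ q S ws t)) vs))
lemma1 m Δ q q≥1 ws (_ , degree≤Δ , _) S VS t _ = marginal , correlation
  where
  open AlgorithmA m Δ q
  open Run S VS q≥1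
  past : List (Subset m)
  past = reverse (take t ws)
  degree-past : ∀ v → degree past v ≡ dAt m Δ q ws t v
  degree-past v = count-reverse (λ w → edge w v) (take t ws)
  bounded : DegreeBound past
  bounded v = ≤-trans (≤-reflexive (degree-past v))
                      (≤-trans (count-mono-⊆ (λ w → edge w v) (take-⊆ t ws)) (degree≤Δ v))
  marginal : (c : Color m Δ q) (v : Fin m) → Pr (Z m Δ q c v) (run past) ≡ frac (Δ ∸ dAt m Δ q ws t v + q) (Δ + q)
  marginal c v = trans (Pr-Z c v past bounded) (cong (λ d → frac (Δ ∸ d + q) (Δ + q)) (degree-past v))
  correlation : (c : Color m Δ q) (vs : List (Fin m)) → Unique vs →
    Pr (allZ m Δ q c vs) (run past) ≤ℚ prodℚ (map (λ v → Pr (Z m Δ q c v) (run past)) vs)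
  correlation c vs uvs = Pr-allZ-≤ c past bounded vs uvs
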